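{- If a graph $G$ of order $n$ and size $m\geq n-1$ is optimal in $\mathcal{G}_{n,m}$, then $G$ is of the form $K_r\vee H$ for some $0\leq r\leq n$, where $H$ has $n-r$ vertices and at most $n-r-2$ edges and $H$ is optimal in $\mathcal{G}_{n-r,|E(H)|}$.
   Context: All graphs are finite and simple. A set $S$ of vertices of a graph $G$ is dominating if every vertex of $G$ is in $S$ or adjacent to a vertex of $S$. The domination polynomial is $D(G,x)=\sum_{i=1}^{|V(G)|} d(G,i)x^i$, where $d(G,i)$ is the number of dominating sets of $G$ of cardinality $i$. $\mathcal{G}_{n,m}$ denotes the set of simple graphs with $n$ vertices and $m$ edges. A graph $H\in\mathcal{G}_{n,m}$ is optimal if $D(H,x)\geq D(G,x)$ for all $G\in\mathcal{G}_{n,m}$ and all $x\geq 0$. The join $G_1\vee G_2$ of disjoint graphs is their disjoint union together with all edges joining a vertex of $G_1$ to a vertex of $G_2$; $K_0\vee H=H$.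
   Formalization: The points x ≥ 0 at which optimality compares domination polynomials range over the nonnegative rationals. -}

module Defs where

open import Data.Bool using (Bool; true; false; _∧_; _∨_; if_then_else_)
open import Data.Nat as ℕ using (ℕ; zero; suc; _<ᵇ_; _≡ᵇ_)
open import Data.Fin using (Fin; toℕ; splitAt)
open import Data.Sum using (inj₁; inj₂)
open import Data.Product using (_×_; _,_)
open import Data.List using (List; []; _∷_; map; _++_; foldr)
open import Data.Bool.ListAction using (any; all)
open import Data.Integer using (+_)
open import Data.List using () renaming (allFin to finList)
open import Data.Vec using (Vec; []; _∷_; lookup)
open import Data.Rational as ℚ using (ℚ; 0ℚ; 1ℚ; _≤_)
open import Relation.Binary.PropositionalEquality using (_≡_; refl)
open import Function.Bundles using (_↔_; Inverse)

record Graph (n : ℕ) : Set where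
  field
    adj    : Fin n → Fin n → Bool
    sym    : ∀ i j → adj i j ≡ adj j i
    irrefl : ∀ i → adj i i ≡ false
open Graph public

countᵇ : {A : Set} → (A → Bool) → List A → ℕ
countᵇ p []       = 0
countᵇ p (x ∷ xs) = if p x then suc (countᵇ p xs) else countᵇ p xs

allPairs : (n : ℕ) → List (Fin n × Fin n)
allPairs n = foldr (λ i acc → map (λ j → (i , j)) (finList n) ++ acc) [] (finList n)

edgeCount : ∀ {n} → Graph n → ℕ
edgeCount {n} G = countᵇ (λ { (i , j) → (toℕ i <ᵇ toℕ j) ∧ adj G i j }) (allPairs n)

VSet : ℕ → Set
VSet n = Vec Bool n

allSubsets : (n : ℕ) → List (VSet n)
allSubsets zero    = [] ∷ []
allSubsets (suc n) = map (true ∷_) (allSubsets n) ++ map (false ∷_) (allSubsets n)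

card : ∀ {n} → VSet n → ℕ
card []          = 0
card (true ∷ s)  = suc (card s)
card (false ∷ s) = card s

isDominating : ∀ {n} → Graph n → VSet n → Bool
isDominating {n} G S =
  all (λ v → lookup S v ∨ any (λ u → lookup S u ∧ adj G u v) (finList n)) (finList n)

domCount : ∀ {n} → Graph n → ℕ → ℕ
domCount {n} G i = countᵇ (λ S → isDominating G S ∧ (card S ≡ᵇ i)) (allSubsets n)

infixr 8 _^ℚ_
_^ℚ_ : ℚ → ℕ → ℚ
x ^ℚ zero  = 1ℚ
x ^ℚ suc k = x ℚ.* (x ^ℚ k)

sumFrom1 : ℕ → (ℕ → ℚ) → ℚ
sumFrom1 zero    f = 0ℚ
sumFrom1 (suc k) f = sumFrom1 k f ℚ.+ f (suc k)

domPoly : ∀ {n} → Graph n → ℚ → ℚ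
domPoly {n} G x = sumFrom1 n (λ i → ((+ domCount G i) ℚ./ 1) ℚ.* (x ^ℚ i))

Optimal : ∀ {n} → Graph n → Set
Optimal {n} G = ∀ (G' : Graph n) → edgeCount G' ≡ edgeCount G →
                ∀ (x : ℚ) → 0ℚ ≤ x → domPoly G' x ≤ domPoly G x

complete : (r : ℕ) → Graph r
complete r = record
  { adj    = λ i j → not (toℕ i ≡ᵇ toℕ j)
  ; sym    = λ i j → cong not (≡ᵇ-sym (toℕ i) (toℕ j))
  ; irrefl = λ i → cong not (≡ᵇ-refl (toℕ i))
  }
  where
    open import Data.Bool using (not)
    open import Relation.Binary.PropositionalEquality using (cong)
    ≡ᵇ-sym : ∀ a b → (a ≡ᵇ b) ≡ (b ≡ᵇ a)
    ≡ᵇ-sym zero zero = refl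
    ≡ᵇ-sym zero (suc b) = refl
    ≡ᵇ-sym (suc a) zero = refl
    ≡ᵇ-sym (suc a) (suc b) = ≡ᵇ-sym a b
    ≡ᵇ-refl : ∀ a → (a ≡ᵇ a) ≡ true
    ≡ᵇ-refl zero = refl
    ≡ᵇ-refl (suc a) = ≡ᵇ-refl a

join : ∀ {a b} → Graph a → Graph b → Graph (a ℕ.+ b)
join {a} {b} G₁ G₂ = record { adj = A ; sym = S ; irrefl = I }
  where
    A : Fin (a ℕ.+ b) → Fin (a ℕ.+ b) → Bool
    A i j with splitAt a i | splitAt a j
    ... | inj₁ x | inj₁ y = adj G₁ x y
    ... | inj₂ x | inj₂ y = adj G₂ x y
    ... | inj₁ _ | inj₂ _ = true
    ... | inj₂ _ | inj₁ _ = true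
    S : ∀ i j → A i j ≡ A j i
    S i j with splitAt a i | splitAt a j
    ... | inj₁ x | inj₁ y = sym G₁ x y
    ... | inj₂ x | inj₂ y = sym G₂ x y
    ... | inj₁ _ | inj₂ _ = refl
    ... | inj₂ _ | inj₁ _ = refl
    I : ∀ i → A i i ≡ false
    I i with splitAt a i
    ... | inj₁ x = irrefl G₁ x
    ... | inj₂ x = irrefl G₂ x

_≅_ : ∀ {n n'} → Graph n → Graph n' → Set
_≅_ {n} {n'} G G' =
  Σ (Fin n ↔ Fin n') λ σ → ∀ i j → adj G' (Inverse.to σ i) (Inverse.to σ j) ≡ adj G i j
  where open import Data.Product using (Σ)

module Submission where

-- Take r = d(G,1), the number of universal vertices of G.  Putting them first gives
-- G ≅ K_r ∨ H with H induced on the other k = n − r vertices (universalDecomposition).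
-- A dominating set of K_r ∨ H either meets K_r, and then its H-part is arbitrary, or it is
-- a dominating set of H; so D(K_r ∨ H, x) = P_{r,k}(x) + D(H, x) with P_{r,k} not
-- depending on H, while |E(K_r ∨ H)| = |E(K_r)| + rk + |E(H)|.  A competitor H' of H
-- thus yields the competitor K_r ∨ H' of G, and cancelling P_{r,k} makes H optimal.
-- Near x = 0 the linear coefficient d(G,1) decides, so an optimal graph has the most
-- universal vertices among graphs of its order and size.  If |E(H)| ≥ k − 1, then
-- K_{r+1} ∨ H'' with |E(H'')| = |E(H)| − (k − 1) has as many edges as G and more
-- universal vertices; hence |E(H)| ≤ k − 2.  (The paper's hypothesis m ≥ n − 1 is unused.)
-- The general facts come first: counting over finite enumerations, invariance under
-- isomorphism, edge counts of joins, then domination in K_r ∨ H and the small-x estimate.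

open import Defs
open import Data.Nat using (ℕ; _+_; _∸_; _≤_)
open import Data.Product using (Σ; _×_; ∃-syntax)
open import Relation.Binary.PropositionalEquality using (_≡_)

open import Data.Bool using (Bool; true; false; _∧_; _∨_; not; if_then_else_)
import Data.Bool.Properties as BP
open import Data.Nat using (zero; suc; _*_; _<ᵇ_; _≡ᵇ_; _<_; z≤n; s≤s)
import Data.Nat.Properties as NP
import Data.Nat.ListAction as NLA
import Data.Nat.ListAction.Properties as NLAP
open import Data.Fin as F using (Fin; toℕ; splitAt; _↑ˡ_; _↑ʳ_)
import Data.Fin.Properties as FP
open import Data.List using (List; []; _∷_; map; _++_; foldr; tabulate; allFin; cartesianProduct)
import Data.List.Properties as LP
open import Data.Bool.ListAction using (any; all; and; or)
open import Data.Product using (_,_; proj₁; proj₂)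
open import Data.Sum using (_⊎_; inj₁; inj₂)
open import Data.Vec as V using ([]; _∷_; lookup)
import Data.Vec.Properties as VP
open import Relation.Binary.PropositionalEquality
  using (refl; trans; cong; cong₂; subst; subst₂; module ≡-Reasoning)
  renaming (sym to ≡-sym)
open import Function using (_∘_; id; _↔_; Inverse; mk⇔; mk↔ₛ′)
open import Data.Empty using (⊥; ⊥-elim)
open import Relation.Nullary using (yes; no)
open import Data.Integer as ℤ using () renaming (+_ to pos)
import Data.Integer.Properties as ZP
open import Data.Rational as ℚ using (ℚ; mkℚ; 0ℚ; 1ℚ)
import Data.Rational.Properties as QP
import Data.Rational.Unnormalised as ℚᵘ
import Data.Rational.Unnormalised.Properties as ℚᵘP
import Data.Nat.Coprimality as Coprime
open import Data.List.Relation.Binary.Permutation.Propositional as Perm using (_↭_)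
import Data.List.Relation.Binary.Permutation.Propositional.Properties as PermP
open import Data.List.Relation.Unary.Unique.Propositional as Uniq using (Unique)
import Data.List.Relation.Unary.All as All
import Data.List.Relation.Unary.Unique.Propositional.Properties as UniqueP
open import Data.List.Membership.Propositional using (_∈_)
import Data.List.Membership.Propositional.Properties as ∈P
open import Data.List.Relation.Unary.Any using (here; there)
open import Data.List.Membership.Propositional.Properties.WithK using (unique∧set⇒bag)
open import Data.List.Relation.Binary.BagAndSetEquality using (∼bag⇒↭)

sumOver : {A : Set} → (A → ℕ) → List A → ℕ
sumOver f xs = NLA.sum (map f xs)

sumOver-++ : {A : Set} (f : A → ℕ) (xs ys : List A) →
  sumOver f (xs ++ ys) ≡ sumOver f xs + sumOver f ys
sumOver-++ f xs ys = trans (cong NLA.sum (LP.map-++ f xs ys)) (NLAP.sum-++ (map f xs) (map f ys))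

sumOver-map : {A B : Set} (f : B → ℕ) (g : A → B) (xs : List A) →
  sumOver f (map g xs) ≡ sumOver (f ∘ g) xs
sumOver-map f g xs = cong NLA.sum (≡-sym (LP.map-∘ xs))

sumOver-cong : {A : Set} {f g : A → ℕ} → (∀ x → f x ≡ g x) → (xs : List A) →
  sumOver f xs ≡ sumOver g xs
sumOver-cong e xs = cong NLA.sum (LP.map-cong e xs)

sumOver-↭ : {A : Set} (f : A → ℕ) {xs ys : List A} → xs ↭ ys → sumOver f xs ≡ sumOver f ys
sumOver-↭ f p = NLAP.sum-↭ (PermP.map⁺ f p)

sumOver-+ : {A : Set} (f g : A → ℕ) (xs : List A) →
  sumOver (λ x → f x + g x) xs ≡ sumOver f xs + sumOver g xs
sumOver-+ f g [] = refl
sumOver-+ f g (x ∷ xs) =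
  trans (cong ((f x + g x) +_) (sumOver-+ f g xs)) (interchange (f x) (g x) (sumOver f xs) (sumOver g xs))
  where
  interchange : ∀ a b c d → (a + b) + (c + d) ≡ (a + c) + (b + d)
  interchange = solve-∀ where open import Data.Nat.Tactic.RingSolver

sumOver-zero : {A : Set} (xs : List A) → sumOver (λ _ → 0) xs ≡ 0
sumOver-zero [] = refl
sumOver-zero (x ∷ xs) = sumOver-zero xs

sumOver-tabulate : {A : Set} (g : A → ℕ) {m : ℕ} (f : Fin m → A) →
  sumOver g (tabulate f) ≡ sumOver (g ∘ f) (allFin m)
sumOver-tabulate g f = cong NLA.sum (trans (LP.map-tabulate f g) (≡-sym (LP.map-tabulate id (g ∘ f))))

indicator : Bool → ℕ
indicator b = if b then 1 else 0

countᵇ≡sumOver : {A : Set} (p : A → Bool) (xs : List A) → countᵇ p xs ≡ sumOver (indicator ∘ p) xs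
countᵇ≡sumOver p [] = refl
countᵇ≡sumOver p (x ∷ xs) with p x
... | true = cong suc (countᵇ≡sumOver p xs)
... | false = countᵇ≡sumOver p xs

countᵇ-++ : {A : Set} (p : A → Bool) (xs ys : List A) → countᵇ p (xs ++ ys) ≡ countᵇ p xs + countᵇ p ys
countᵇ-++ p [] ys = refl
countᵇ-++ p (x ∷ xs) ys with p x
... | true = cong suc (countᵇ-++ p xs ys)
... | false = countᵇ-++ p xs ys

countᵇ-map : {A B : Set} (p : B → Bool) (f : A → B) (xs : List A) → countᵇ p (map f xs) ≡ countᵇ (p ∘ f) xs
countᵇ-map p f [] = refl
countᵇ-map p f (x ∷ xs) with p (f x)
... | true = cong suc (countᵇ-map p f xs)
... | false = countᵇ-map p f xs

countᵇ-cong : {A : Set} {p q : A → Bool} → (∀ x → p x ≡ q x) → (xs : List A) → countᵇ p xs ≡ countᵇ q xs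
countᵇ-cong e [] = refl
countᵇ-cong {q = q} e (x ∷ xs) rewrite e x with q x
... | true = cong suc (countᵇ-cong e xs)
... | false = countᵇ-cong e xs

countᵇ-↭ : {A : Set} (p : A → Bool) {xs ys : List A} → xs ↭ ys → countᵇ p xs ≡ countᵇ p ys
countᵇ-↭ p {xs} {ys} e =
  trans (countᵇ≡sumOver p xs) (trans (sumOver-↭ (indicator ∘ p) e) (≡-sym (countᵇ≡sumOver p ys)))

countᵇ-tabulate : {A : Set} (p : A → Bool) {n : ℕ} (f : Fin n → A) →
  countᵇ p (tabulate f) ≡ countᵇ (p ∘ f) (allFin n)
countᵇ-tabulate p {zero} f = refl
countᵇ-tabulate p {suc n} f with p (f F.zero)
... | true = cong suc (trans (countᵇ-tabulate p (f ∘ F.suc)) (≡-sym (countᵇ-tabulate (p ∘ f) F.suc)))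
... | false = trans (countᵇ-tabulate p (f ∘ F.suc)) (≡-sym (countᵇ-tabulate (p ∘ f) F.suc))

countᵇ-if : {A : Set} (c p q : A → Bool) (xs : List A) →
  countᵇ (λ x → if c x then p x else q x) xs ≡ countᵇ (λ x → c x ∧ p x) xs + countᵇ (λ x → not (c x) ∧ q x) xs
countᵇ-if c p q [] = refl
countᵇ-if c p q (x ∷ xs) with c x
countᵇ-if c p q (x ∷ xs) | true with p x
... | true = cong suc (countᵇ-if c p q xs)
... | false = countᵇ-if c p q xs
countᵇ-if c p q (x ∷ xs) | false with q x
... | true = trans (cong suc (countᵇ-if c p q xs)) (≡-sym (NP.+-suc _ _))
... | false = countᵇ-if c p q xs

countᵇ-none : {A : Set} (p : A → Bool) → (∀ x → p x ≡ false) → (xs : List A) → countᵇ p xs ≡ 0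
countᵇ-none p e [] = refl
countᵇ-none p e (x ∷ xs) rewrite e x = countᵇ-none p e xs

countᵇ-mono : {A : Set} (p q : A → Bool) → (∀ x → p x ≡ true → q x ≡ true) → (xs : List A) →
  countᵇ p xs ≤ countᵇ q xs
countᵇ-mono p q h [] = z≤n
countᵇ-mono p q h (x ∷ xs) with p x in eq
... | true rewrite h x eq = s≤s (countᵇ-mono p q h xs)
... | false with q x
... | true = NP.m≤n⇒m≤1+n (countᵇ-mono p q h xs)
... | false = countᵇ-mono p q h xs

and-↭ : {xs ys : List Bool} → xs ↭ ys → and xs ≡ and ys
and-↭ Perm.refl = refl
and-↭ (Perm.prep x e) = cong (x ∧_) (and-↭ e)
and-↭ (Perm.swap x y e) = trans (≡-sym (BP.∧-assoc x y _)) (trans (cong (_∧ _) (BP.∧-comm x y))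
  (trans (BP.∧-assoc y x _) (cong (λ z → y ∧ (x ∧ z)) (and-↭ e))))
and-↭ (Perm.trans e e') = trans (and-↭ e) (and-↭ e')

or-↭ : {xs ys : List Bool} → xs ↭ ys → or xs ≡ or ys
or-↭ Perm.refl = refl
or-↭ (Perm.prep x e) = cong (x ∨_) (or-↭ e)
or-↭ (Perm.swap x y e) = trans (≡-sym (BP.∨-assoc x y _)) (trans (cong (_∨ _) (BP.∨-comm x y))
  (trans (BP.∨-assoc y x _) (cong (λ z → y ∨ (x ∨ z)) (or-↭ e))))
or-↭ (Perm.trans e e') = trans (or-↭ e) (or-↭ e')

all-↭ : {A : Set} (p : A → Bool) {xs ys : List A} → xs ↭ ys → all p xs ≡ all p ys
all-↭ p e = and-↭ (PermP.map⁺ p e)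

any-↭ : {A : Set} (p : A → Bool) {xs ys : List A} → xs ↭ ys → any p xs ≡ any p ys
any-↭ p e = or-↭ (PermP.map⁺ p e)

all-map : {A B : Set} (p : B → Bool) (f : A → B) (xs : List A) → all p (map f xs) ≡ all (p ∘ f) xs
all-map p f xs = cong and (≡-sym (LP.map-∘ xs))

any-map : {A B : Set} (p : B → Bool) (f : A → B) (xs : List A) → any p (map f xs) ≡ any (p ∘ f) xs
any-map p f xs = cong or (≡-sym (LP.map-∘ xs))

all-cong : {A : Set} {p q : A → Bool} → (∀ x → p x ≡ q x) → (xs : List A) → all p xs ≡ all q xs
all-cong e xs = cong and (LP.map-cong e xs)

any-cong : {A : Set} {p q : A → Bool} → (∀ x → p x ≡ q x) → (xs : List A) → any p xs ≡ any q xs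
any-cong e xs = cong or (LP.map-cong e xs)

all-tabulate : {A : Set} (p : A → Bool) {n : ℕ} (f : Fin n → A) → all p (tabulate f) ≡ all (p ∘ f) (allFin n)
all-tabulate p f = cong and (trans (LP.map-tabulate f p) (≡-sym (LP.map-tabulate id (p ∘ f))))

any-tabulate : {A : Set} (p : A → Bool) {n : ℕ} (f : Fin n → A) → any p (tabulate f) ≡ any (p ∘ f) (allFin n)
any-tabulate p f = cong or (trans (LP.map-tabulate f p) (≡-sym (LP.map-tabulate id (p ∘ f))))

∧-true-inv : ∀ {a b} → (a ∧ b) ≡ true → (a ≡ true) × (b ≡ true)
∧-true-inv {true} {true} e = refl , refl

all-intro : {A : Set} (p : A → Bool) (xs : List A) → (∀ x → p x ≡ true) → all p xs ≡ true
all-intro p [] h = refl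
all-intro p (x ∷ xs) h rewrite h x = all-intro p xs h

all-elim : {A : Set} (p : A → Bool) (xs : List A) → all p xs ≡ true → ∀ {x} → x ∈ xs → p x ≡ true
all-elim p (y ∷ xs) e (here refl) = proj₁ (∧-true-inv e)
all-elim p (y ∷ xs) e (there m) = all-elim p xs (proj₂ (∧-true-inv e)) m

any-intro : {A : Set} (p : A → Bool) (xs : List A) {x : A} → x ∈ xs → p x ≡ true → any p xs ≡ true
any-intro p (y ∷ xs) (here refl) e rewrite e = refl
any-intro p (y ∷ xs) (there m) e rewrite any-intro p xs m e = BP.∨-zeroʳ (p y)

any-elim : {A : Set} (p : A → Bool) (xs : List A) → any p xs ≡ true → Σ A λ x → p x ≡ true
any-elim p (y ∷ xs) e with p y in q
... | true = y , q
... | false = any-elim p xs e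

any-false-intro : {A : Set} (p : A → Bool) (xs : List A) → (∀ x → p x ≡ false) → any p xs ≡ false
any-false-intro p [] h = refl
any-false-intro p (x ∷ xs) h rewrite h x = any-false-intro p xs h

any-false-elim : {A : Set} (p : A → Bool) (xs : List A) → any p xs ≡ false → ∀ {x} → x ∈ xs → p x ≡ false
any-false-elim p (y ∷ xs) e m with p y in q
any-false-elim p (y ∷ xs) () m | true
any-false-elim p (y ∷ xs) e (here refl) | false = q
any-false-elim p (y ∷ xs) e (there m) | false = any-false-elim p xs e m

any-false⇒countᵇ≡0 : {A : Set} (p : A → Bool) (xs : List A) → any p xs ≡ false → countᵇ p xs ≡ 0
any-false⇒countᵇ≡0 p [] e = refl
any-false⇒countᵇ≡0 p (x ∷ xs) e with p x
any-false⇒countᵇ≡0 p (x ∷ xs) () | true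
... | false = any-false⇒countᵇ≡0 p xs e

record Enumeration (A : Set) : Set where
  field
    list     : List A
    unique   : Unique list
    covers   : ∀ a → a ∈ list
open Enumeration

map-bijection-↭ : {A B : Set} (EA : Enumeration A) (EB : Enumeration B) (f : A → B) (g : B → A) →
  (∀ a → g (f a) ≡ a) → (∀ b → f (g b) ≡ b) → map f (list EA) ↭ list EB
map-bijection-↭ EA EB f g gf fg = ∼bag⇒↭ (unique∧set⇒bag (UniqueP.map⁺ f-injective (unique EA)) (unique EB)
  (λ {b} → mk⇔ (λ _ → covers EB _)
                (λ _ → subst (_∈ map f (list EA)) (fg b) (∈P.∈-map⁺ f (covers EA (g b))))))
  where
  f-injective : ∀ {x y} → f x ≡ f y → x ≡ y
  f-injective {x} {y} e = trans (≡-sym (gf x)) (trans (cong g e) (gf y))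

module Reindex {A B : Set} (EA : Enumeration A) (EB : Enumeration B) (f : A → B) (g : B → A)
  (gf : ∀ a → g (f a) ≡ a) (fg : ∀ b → f (g b) ≡ b) where

  permutation : map f (list EA) ↭ list EB
  permutation = map-bijection-↭ EA EB f g gf fg

  countᵇ-reindex : (p : B → Bool) → countᵇ (p ∘ f) (list EA) ≡ countᵇ p (list EB)
  countᵇ-reindex p = trans (≡-sym (countᵇ-map p f (list EA))) (countᵇ-↭ p permutation)

  all-reindex : (p : B → Bool) → all (p ∘ f) (list EA) ≡ all p (list EB)
  all-reindex p = trans (≡-sym (all-map p f (list EA))) (all-↭ p permutation)

  any-reindex : (p : B → Bool) → any (p ∘ f) (list EA) ≡ any p (list EB)
  any-reindex p = trans (≡-sym (any-map p f (list EA))) (any-↭ p permutation)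

enumFin : (n : ℕ) → Enumeration (Fin n)
enumFin n = record { list = allFin n ; unique = UniqueP.allFin⁺ n ; covers = ∈P.∈-allFin }

allPairs≡cartesianProduct : (n : ℕ) → allPairs n ≡ cartesianProduct (allFin n) (allFin n)
allPairs≡cartesianProduct n = go (allFin n)
  where
  go : (xs : List (Fin n)) →
    foldr (λ i acc → map (λ j → (i , j)) (allFin n) ++ acc) [] xs ≡ cartesianProduct xs (allFin n)
  go [] = refl
  go (x ∷ xs) = cong (map (λ j → (x , j)) (allFin n) ++_) (go xs)

enumPairs : (n : ℕ) → Enumeration (Fin n × Fin n)
enumPairs n = record
  { list = allPairs n
  ; unique = subst Unique (≡-sym (allPairs≡cartesianProduct n))
                   (UniqueP.cartesianProduct⁺ (UniqueP.allFin⁺ n) (UniqueP.allFin⁺ n))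
  ; covers = λ { (i , j) → subst ((i , j) ∈_) (≡-sym (allPairs≡cartesianProduct n))
                                   (∈P.∈-cartesianProduct⁺ (∈P.∈-allFin i) (∈P.∈-allFin j)) } }

-- the two halves of allSubsets (suc n) are disjoint images of allSubsets n
∷-injectiveʳ : {n : ℕ} {b : Bool} {x y : VSet n} → _≡_ {A = VSet (suc n)} (b ∷ x) (b ∷ y) → x ≡ y
∷-injectiveʳ refl = refl

allSubsets-unique : (n : ℕ) → Unique (allSubsets n)
allSubsets-unique zero = All.[] Uniq.∷ Uniq.[]
allSubsets-unique (suc n) =
  UniqueP.++⁺ (UniqueP.map⁺ ∷-injectiveʳ (allSubsets-unique n)) (UniqueP.map⁺ ∷-injectiveʳ (allSubsets-unique n)) disjoint
  where
  disjoint : ∀ {v} → v ∈ map (true ∷_) (allSubsets n) × v ∈ map (false ∷_) (allSubsets n) → ⊥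
  disjoint (a , b) with ∈P.∈-map⁻ (true ∷_) a | ∈P.∈-map⁻ (false ∷_) b
  ... | (x , _ , refl) | (y , _ , ())

allSubsets-complete : (n : ℕ) (S : VSet n) → S ∈ allSubsets n
allSubsets-complete zero [] = here refl
allSubsets-complete (suc n) (true ∷ S) = ∈P.∈-++⁺ˡ (∈P.∈-map⁺ (true ∷_) (allSubsets-complete n S))
allSubsets-complete (suc n) (false ∷ S) =
  ∈P.∈-++⁺ʳ (map (true ∷_) (allSubsets n)) (∈P.∈-map⁺ (false ∷_) (allSubsets-complete n S))

enumSubsets : (n : ℕ) → Enumeration (VSet n)
enumSubsets n = record { list = allSubsets n ; unique = allSubsets-unique n ; covers = allSubsets-complete n }

sumFin : (n : ℕ) → (Fin n → ℕ) → ℕ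
sumFin n g = sumOver g (allFin n)

sumFin-suc : ∀ n (g : Fin (suc n) → ℕ) → sumFin (suc n) g ≡ g F.zero + sumFin n (g ∘ F.suc)
sumFin-suc n g = cong (g F.zero +_) (sumOver-tabulate g F.suc)

sumFin-+ : ∀ a {b} (g : Fin (a + b) → ℕ) → sumFin (a + b) g ≡ sumFin a (g ∘ (_↑ˡ b)) + sumFin b (g ∘ (a ↑ʳ_))
sumFin-+ zero g = refl
sumFin-+ (suc a) {b} g = begin
  sumFin (suc a + b) g                                          ≡⟨ sumFin-suc (a + b) g ⟩
  g F.zero + sumFin (a + b) (g ∘ F.suc)                         ≡⟨ cong (g F.zero +_) (sumFin-+ a (g ∘ F.suc)) ⟩
  g F.zero + (sumFin a (g ∘ F.suc ∘ (_↑ˡ b)) + sumFin b (g ∘ F.suc ∘ (a ↑ʳ_)))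
                                                                ≡⟨ ≡-sym (NP.+-assoc (g F.zero) _ _) ⟩
  (g F.zero + sumFin a (g ∘ F.suc ∘ (_↑ˡ b))) + sumFin b (g ∘ F.suc ∘ (a ↑ʳ_))
                                                                ≡⟨ cong (_+ sumFin b (g ∘ F.suc ∘ (a ↑ʳ_))) (≡-sym (sumFin-suc a (g ∘ (_↑ˡ b)))) ⟩
  sumFin (suc a) (g ∘ (_↑ˡ b)) + sumFin b (g ∘ (suc a ↑ʳ_))    ∎
  where open ≡-Reasoning

sumFin-const : ∀ n c → sumFin n (λ _ → c) ≡ n * c
sumFin-const zero c = refl
sumFin-const (suc n) c = trans (sumFin-suc n (λ _ → c)) (cong (c +_) (sumFin-const n c))

countFin-+ : ∀ a {b} (p : Fin (a + b) → Bool) →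
  countᵇ p (allFin (a + b)) ≡ countᵇ (p ∘ (_↑ˡ b)) (allFin a) + countᵇ (p ∘ (a ↑ʳ_)) (allFin b)
countFin-+ a {b} p = begin
  countᵇ p (allFin (a + b))                                ≡⟨ countᵇ≡sumOver p (allFin (a + b)) ⟩
  sumFin (a + b) (indicator ∘ p)                          ≡⟨ sumFin-+ a (indicator ∘ p) ⟩
  sumFin a (indicator ∘ p ∘ (_↑ˡ b)) + sumFin b (indicator ∘ p ∘ (a ↑ʳ_))
        ≡⟨ ≡-sym (cong₂ _+_ (countᵇ≡sumOver (p ∘ (_↑ˡ b)) (allFin a)) (countᵇ≡sumOver (p ∘ (a ↑ʳ_)) (allFin b))) ⟩
  countᵇ (p ∘ (_↑ˡ b)) (allFin a) + countᵇ (p ∘ (a ↑ʳ_)) (allFin b) ∎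
  where open ≡-Reasoning

countFin-true : ∀ n → countᵇ (λ (_ : Fin n) → true) (allFin n) ≡ n
countFin-true n = trans (countᵇ≡sumOver _ (allFin n)) (trans (sumFin-const n 1) (NP.*-identityʳ n))

allFin-+ : ∀ a {b} (p : Fin (a + b) → Bool) →
  all p (allFin (a + b)) ≡ (all (p ∘ (_↑ˡ b)) (allFin a) ∧ all (p ∘ (a ↑ʳ_)) (allFin b))
allFin-+ zero p = refl
allFin-+ (suc a) {b} p = begin
  p F.zero ∧ all p (tabulate F.suc)                       ≡⟨ cong (p F.zero ∧_) (all-tabulate p F.suc) ⟩
  p F.zero ∧ all (p ∘ F.suc) (allFin (a + b))             ≡⟨ cong (p F.zero ∧_) (allFin-+ a (p ∘ F.suc)) ⟩
  p F.zero ∧ (all (p ∘ F.suc ∘ (_↑ˡ b)) (allFin a) ∧ all (p ∘ F.suc ∘ (a ↑ʳ_)) (allFin b))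
                                                          ≡⟨ ≡-sym (BP.∧-assoc (p F.zero) _ _) ⟩
  (p F.zero ∧ all (p ∘ F.suc ∘ (_↑ˡ b)) (allFin a)) ∧ all (p ∘ F.suc ∘ (a ↑ʳ_)) (allFin b)
      ≡⟨ cong (λ z → (p F.zero ∧ z) ∧ all (p ∘ F.suc ∘ (a ↑ʳ_)) (allFin b)) (≡-sym (all-tabulate (p ∘ (_↑ˡ b)) F.suc)) ⟩
  (p F.zero ∧ all (p ∘ (_↑ˡ b)) (tabulate F.suc)) ∧ all (p ∘ F.suc ∘ (a ↑ʳ_)) (allFin b) ∎
  where open ≡-Reasoning

anyFin-+ : ∀ a {b} (p : Fin (a + b) → Bool) →
  any p (allFin (a + b)) ≡ (any (p ∘ (_↑ˡ b)) (allFin a) ∨ any (p ∘ (a ↑ʳ_)) (allFin b))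
anyFin-+ zero p = refl
anyFin-+ (suc a) {b} p = begin
  p F.zero ∨ any p (tabulate F.suc)                       ≡⟨ cong (p F.zero ∨_) (any-tabulate p F.suc) ⟩
  p F.zero ∨ any (p ∘ F.suc) (allFin (a + b))             ≡⟨ cong (p F.zero ∨_) (anyFin-+ a (p ∘ F.suc)) ⟩
  p F.zero ∨ (any (p ∘ F.suc ∘ (_↑ˡ b)) (allFin a) ∨ any (p ∘ F.suc ∘ (a ↑ʳ_)) (allFin b))
                                                          ≡⟨ ≡-sym (BP.∨-assoc (p F.zero) _ _) ⟩
  (p F.zero ∨ any (p ∘ F.suc ∘ (_↑ˡ b)) (allFin a)) ∨ any (p ∘ F.suc ∘ (a ↑ʳ_)) (allFin b)
      ≡⟨ cong (λ z → (p F.zero ∨ z) ∨ any (p ∘ F.suc ∘ (a ↑ʳ_)) (allFin b)) (≡-sym (any-tabulate (p ∘ (_↑ˡ b)) F.suc)) ⟩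
  (p F.zero ∨ any (p ∘ (_↑ˡ b)) (tabulate F.suc)) ∨ any (p ∘ F.suc ∘ (a ↑ʳ_)) (allFin b) ∎
  where open ≡-Reasoning

arcCount : ∀ {n} → Graph n → ℕ
arcCount {n} G = countᵇ (λ p → adj G (proj₁ p) (proj₂ p)) (allPairs n)

data Compareᵇ (a b : ℕ) : Set where
  less    : (a <ᵇ b) ≡ true → (b <ᵇ a) ≡ false → Compareᵇ a b
  equal   : a ≡ b → Compareᵇ a b
  greater : (a <ᵇ b) ≡ false → (b <ᵇ a) ≡ true → Compareᵇ a b

compareᵇ : (a b : ℕ) → Compareᵇ a b
compareᵇ zero zero = equal refl
compareᵇ zero (suc b) = less refl refl
compareᵇ (suc a) zero = greater refl refl
compareᵇ (suc a) (suc b) with compareᵇ a b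
... | less x y = less x y
... | equal e = equal (cong suc e)
... | greater x y = greater x y

n<ᵇn : ∀ a → (a <ᵇ a) ≡ false
n<ᵇn zero = refl
n<ᵇn (suc a) = n<ᵇn a

-- Every edge is counted once as (i , j) with i < j and once as (j , i).
arcCount≡2·edgeCount : ∀ {n} (G : Graph n) → arcCount G ≡ edgeCount G + edgeCount G
arcCount≡2·edgeCount {n} G = begin
  arcCount G                                                  ≡⟨ countᵇ-cong (λ p → if-same (c p) (a p)) (allPairs n) ⟩
  countᵇ (λ p → if c p then a p else a p) (allPairs n)        ≡⟨ countᵇ-if c a a (allPairs n) ⟩
  edgeCount G + countᵇ (λ p → not (c p) ∧ a p) (allPairs n)   ≡⟨ cong (edgeCount G +_) backwards ⟩
  edgeCount G + edgeCount G                                   ∎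
  where
  open ≡-Reasoning
  c a : Fin n × Fin n → Bool
  c p = toℕ (proj₁ p) <ᵇ toℕ (proj₂ p)
  a p = adj G (proj₁ p) (proj₂ p)
  if-same : ∀ (b x : Bool) → x ≡ (if b then x else x)
  if-same true x = refl
  if-same false x = refl
  swap : Fin n × Fin n → Fin n × Fin n
  swap (i , j) = (j , i)
  -- the pairs with i ≥ j that are adjacent are exactly the swaps of the edges
  swapped : ∀ p → (not (c p) ∧ a p) ≡ ((c ∘ swap) p ∧ (a ∘ swap) p)
  swapped (i , j) with compareᵇ (toℕ i) (toℕ j)
  ... | less x y rewrite x | y = refl
  ... | greater x y rewrite x | y = Graph.sym G i j
  ... | equal e rewrite FP.toℕ-injective e | irrefl G j | n<ᵇn (toℕ j) = refl
  backwards : countᵇ (λ p → not (c p) ∧ a p) (allPairs n) ≡ edgeCount G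
  backwards = trans (countᵇ-cong swapped (allPairs n))
    (Reindex.countᵇ-reindex (enumPairs n) (enumPairs n) swap swap (λ _ → refl) (λ _ → refl) (λ p → c p ∧ a p))

double-injective : ∀ a b → a + a ≡ b + b → a ≡ b
double-injective a b e = NP.*-cancelˡ-≡ a b 2 (trans (cong (a +_) (NP.+-identityʳ a)) (trans e (cong (b +_) (≡-sym (NP.+-identityʳ b)))))

degree : ∀ {n} → Graph n → Fin n → ℕ
degree {n} G i = countᵇ (adj G i) (allFin n)

arcCount≡Σdegree : ∀ {n} (G : Graph n) → arcCount G ≡ sumFin n (degree G)
arcCount≡Σdegree {n} G = go (allFin n)
  where
  go : (xs : List (Fin n)) →
    countᵇ (λ p → adj G (proj₁ p) (proj₂ p)) (foldr (λ i acc → map (λ j → (i , j)) (allFin n) ++ acc) [] xs)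
      ≡ sumOver (degree G) xs
  go [] = refl
  go (x ∷ xs) = trans (countᵇ-++ _ (map (λ j → (x , j)) (allFin n)) _)
                      (cong₂ _+_ (countᵇ-map _ (λ j → (x , j)) (allFin n)) (go xs))

2·edgeCount≡Σdegree : ∀ {n} (G : Graph n) → edgeCount G + edgeCount G ≡ sumFin n (degree G)
2·edgeCount≡Σdegree G = trans (≡-sym (arcCount≡2·edgeCount G)) (arcCount≡Σdegree G)

coeff : ℕ → ℚ
coeff a = (pos a) ℚ./ 1

coeffNF : ℕ → ℚ
coeffNF a = mkℚ (pos a) 0 (Coprime.sym (Coprime.1-coprimeTo a))

coeff≡coeffNF : ∀ a → coeff a ≡ coeffNF a
coeff≡coeffNF a = QP.↥p/↧p≡p (coeffNF a)

coeff-nonneg : ∀ a → 0ℚ ℚ.≤ coeff a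
coeff-nonneg a rewrite coeff≡coeffNF a = QP.nonNegative⁻¹ (coeffNF a)

coeff-mono : ∀ {a b} → a ≤ b → coeff a ℚ.≤ coeff b
coeff-mono {a} {b} le rewrite coeff≡coeffNF a | coeff≡coeffNF b =
  ℚ.*≤* (subst₂ ℤ._≤_ (≡-sym (ZP.*-identityʳ (pos a))) (≡-sym (ZP.*-identityʳ (pos b))) (ℤ.+≤+ le))

coeff-+ : ∀ a b → coeff (a + b) ≡ coeff a ℚ.+ coeff b
coeff-+ a b rewrite coeff≡coeffNF a | coeff≡coeffNF b | coeff≡coeffNF (a + b) =
  QP.toℚᵘ-injective (ℚᵘP.≃-sym (ℚᵘP.≃-trans (QP.toℚᵘ-homo-+ (coeffNF a) (coeffNF b)) (ℚᵘ.*≡* cross-multiplied)))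
  where
  normalise : ∀ (x y : ℤ.ℤ) → (x ℤ.* pos 1 ℤ.+ y ℤ.* pos 1) ℤ.* pos 1 ≡ (x ℤ.+ y) ℤ.* (pos 1 ℤ.* pos 1)
  normalise = solve-∀ where open import Data.Integer.Tactic.RingSolver
  cross-multiplied : (pos a ℤ.* pos 1 ℤ.+ pos b ℤ.* pos 1) ℤ.* pos 1 ≡ pos (a + b) ℤ.* (pos 1 ℤ.* pos 1)
  cross-multiplied = trans (normalise (pos a) (pos b)) (cong (ℤ._* (pos 1 ℤ.* pos 1)) (≡-sym (ZP.pos-+ a b)))

card≡countᵇ : ∀ {m} (S : VSet m) → card S ≡ countᵇ (lookup S) (allFin m)
card≡countᵇ [] = refl
card≡countᵇ (true ∷ S) = cong suc (trans (card≡countᵇ S) (≡-sym (countᵇ-tabulate (lookup (true ∷ S)) F.suc)))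
card≡countᵇ (false ∷ S) = trans (card≡countᵇ S) (≡-sym (countᵇ-tabulate (lookup (false ∷ S)) F.suc))

sumFrom1-cong : ∀ N {f g : ℕ → ℚ} → (∀ i → f (suc i) ≡ g (suc i)) → sumFrom1 N f ≡ sumFrom1 N g
sumFrom1-cong zero e = refl
sumFrom1-cong (suc N) e = cong₂ ℚ._+_ (sumFrom1-cong N e) (e N)

domPoly-cong : ∀ {n} (G H : Graph n) → (∀ i → domCount G i ≡ domCount H i) → ∀ x → domPoly G x ≡ domPoly H x
domPoly-cong {n} G H e x = sumFrom1-cong n (λ i → cong (λ d → coeff d ℚ.* (x ^ℚ suc i)) (e (suc i)))

module Isomorphism {n n' : ℕ} (G : Graph n) (G' : Graph n') (iso : G ≅ G') where
  σ : Fin n ↔ Fin n'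
  σ = proj₁ iso
  to : Fin n → Fin n'
  to = Inverse.to σ
  from : Fin n' → Fin n
  from = Inverse.from σ
  to-from : ∀ y → to (from y) ≡ y
  to-from = Inverse.strictlyInverseˡ σ
  from-to : ∀ x → from (to x) ≡ x
  from-to = Inverse.strictlyInverseʳ σ
  preserves : ∀ i j → adj G' (to i) (to j) ≡ adj G i j
  preserves = proj₂ iso

  order : n ≡ n'
  order = FP.cantor-schröder-bernstein (injective to from from-to) (injective from to to-from)
    where
    injective : ∀ {a b} (f : Fin a → Fin b) (g : Fin b → Fin a) → (∀ x → g (f x) ≡ x) → ∀ {x y} → f x ≡ f y → x ≡ y
    injective f g gf {x} {y} e = trans (≡-sym (gf x)) (trans (cong g e) (gf y))

  edgeCount-preserved : edgeCount G ≡ edgeCount G'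
  edgeCount-preserved = double-injective _ _ (begin
    edgeCount G + edgeCount G     ≡⟨ ≡-sym (arcCount≡2·edgeCount G) ⟩
    arcCount G                    ≡⟨ countᵇ-cong (λ { (i , j) → ≡-sym (preserves i j) }) (allPairs n) ⟩
    countᵇ (λ p → adj G' (to (proj₁ p)) (to (proj₂ p))) (allPairs n)
       ≡⟨ Reindex.countᵇ-reindex (enumPairs n) (enumPairs n') (λ { (i , j) → to i , to j }) (λ { (i , j) → from i , from j })
            (λ { (i , j) → cong₂ _,_ (from-to i) (from-to j) }) (λ { (i , j) → cong₂ _,_ (to-from i) (to-from j) })
            (λ p → adj G' (proj₁ p) (proj₂ p)) ⟩
    arcCount G'                   ≡⟨ arcCount≡2·edgeCount G' ⟩
    edgeCount G' + edgeCount G'   ∎)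
    where open ≡-Reasoning

  image : VSet n → VSet n'
  image S = V.tabulate (λ j → lookup S (from j))
  preimage : VSet n' → VSet n
  preimage S = V.tabulate (λ i → lookup S (to i))

  lookup-image : ∀ S i → lookup (image S) (to i) ≡ lookup S i
  lookup-image S i = trans (VP.lookup∘tabulate _ (to i)) (cong (lookup S) (from-to i))

  preimage-image : ∀ S → preimage (image S) ≡ S
  preimage-image S = trans (VP.tabulate-cong (lookup-image S)) (VP.tabulate∘lookup S)
  image-preimage : ∀ S → image (preimage S) ≡ S
  image-preimage S = trans (VP.tabulate-cong (λ j → trans (VP.lookup∘tabulate _ (from j)) (cong (lookup S) (to-from j))))
                           (VP.tabulate∘lookup S)

  card-image : ∀ S → card (image S) ≡ card S
  card-image S = begin
    card (image S)                       ≡⟨ card≡countᵇ (image S) ⟩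
    countᵇ (lookup (image S)) (allFin n') ≡⟨ ≡-sym (Reindex.countᵇ-reindex (enumFin n) (enumFin n') to from from-to to-from _) ⟩
    countᵇ (lookup (image S) ∘ to) (allFin n) ≡⟨ countᵇ-cong (lookup-image S) (allFin n) ⟩
    countᵇ (lookup S) (allFin n)          ≡⟨ ≡-sym (card≡countᵇ S) ⟩
    card S                               ∎
    where open ≡-Reasoning

  isDominating-image : ∀ S → isDominating G' (image S) ≡ isDominating G S
  isDominating-image S =
    trans (≡-sym (Reindex.all-reindex (enumFin n) (enumFin n') to from from-to to-from dominated')) (all-cong dominated-to (allFin n))
    where
    dominated' : Fin n' → Bool
    dominated' v = lookup (image S) v ∨ any (λ u → lookup (image S) u ∧ adj G' u v) (allFin n')
    dominated-to : ∀ v → dominated' (to v) ≡ (lookup S v ∨ any (λ u → lookup S u ∧ adj G u v) (allFin n))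
    dominated-to v = cong₂ _∨_ (lookup-image S v)
      (trans (≡-sym (Reindex.any-reindex (enumFin n) (enumFin n') to from from-to to-from (λ u → lookup (image S) u ∧ adj G' u (to v))))
             (any-cong (λ u → cong₂ _∧_ (lookup-image S u) (preserves u v)) (allFin n)))

  domCount-preserved : ∀ i → domCount G i ≡ domCount G' i
  domCount-preserved i =
    trans (countᵇ-cong (λ S → ≡-sym (cong₂ (λ a b → a ∧ (b ≡ᵇ i)) (isDominating-image S) (card-image S))) (allSubsets n))
          (Reindex.countᵇ-reindex (enumSubsets n) (enumSubsets n') image preimage preimage-image image-preimage
             (λ S → isDominating G' S ∧ (card S ≡ᵇ i)))

  domPoly-preserved : ∀ x → domPoly G x ≡ domPoly G' x
  domPoly-preserved x = go order G' domCount-preserved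
    where
    go : ∀ {m} → n ≡ m → (H : Graph m) → (∀ i → domCount G i ≡ domCount H i) → domPoly G x ≡ domPoly H x
    go refl H e = domPoly-cong G H e x

module JoinAdjacency {a b : ℕ} (G₁ : Graph a) (G₂ : Graph b) where
  joinAdj : Fin a ⊎ Fin b → Fin a ⊎ Fin b → Bool
  joinAdj (inj₁ x) (inj₁ y) = adj G₁ x y
  joinAdj (inj₂ x) (inj₂ y) = adj G₂ x y
  joinAdj (inj₁ _) (inj₂ _) = true
  joinAdj (inj₂ _) (inj₁ _) = true

  adj-join : ∀ i j → adj (join G₁ G₂) i j ≡ joinAdj (splitAt a i) (splitAt a j)
  adj-join i j with splitAt a i | splitAt a j
  ... | inj₁ x | inj₁ y = refl
  ... | inj₂ x | inj₂ y = refl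
  ... | inj₁ x | inj₂ y = refl
  ... | inj₂ x | inj₁ y = refl

  adj-ll : ∀ x y → adj (join G₁ G₂) (x ↑ˡ b) (y ↑ˡ b) ≡ adj G₁ x y
  adj-ll x y rewrite adj-join (x ↑ˡ b) (y ↑ˡ b) | FP.splitAt-↑ˡ a x b | FP.splitAt-↑ˡ a y b = refl
  adj-lr : ∀ x y → adj (join G₁ G₂) (x ↑ˡ b) (a ↑ʳ y) ≡ true
  adj-lr x y rewrite adj-join (x ↑ˡ b) (a ↑ʳ y) | FP.splitAt-↑ˡ a x b | FP.splitAt-↑ʳ a b y = refl
  adj-rl : ∀ x y → adj (join G₁ G₂) (a ↑ʳ x) (y ↑ˡ b) ≡ true
  adj-rl x y rewrite adj-join (a ↑ʳ x) (y ↑ˡ b) | FP.splitAt-↑ˡ a y b | FP.splitAt-↑ʳ a b x = refl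
  adj-rr : ∀ x y → adj (join G₁ G₂) (a ↑ʳ x) (a ↑ʳ y) ≡ adj G₂ x y
  adj-rr x y rewrite adj-join (a ↑ʳ x) (a ↑ʳ y) | FP.splitAt-↑ʳ a b x | FP.splitAt-↑ʳ a b y = refl

edgeCount-join : ∀ {a b} (G₁ : Graph a) (G₂ : Graph b) →
  edgeCount (join G₁ G₂) ≡ edgeCount G₁ + a * b + edgeCount G₂
edgeCount-join {a} {b} G₁ G₂ = double-injective _ _ (begin
  e + e                                                        ≡⟨ 2·edgeCount≡Σdegree J ⟩
  sumFin (a + b) (degree J)                                    ≡⟨ sumFin-+ a (degree J) ⟩
  sumFin a (degree J ∘ (_↑ˡ b)) + sumFin b (degree J ∘ (a ↑ʳ_))
                                                ≡⟨ cong₂ _+_ (sumOver-cong degree-left (allFin a)) (sumOver-cong degree-right (allFin b)) ⟩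
  sumFin a (λ i → degree G₁ i + b) + sumFin b (λ j → a + degree G₂ j)
                            ≡⟨ cong₂ _+_ (sumOver-+ (degree G₁) (λ _ → b) (allFin a)) (sumOver-+ (λ _ → a) (degree G₂) (allFin b)) ⟩
  (sumFin a (degree G₁) + sumFin a (λ _ → b)) + (sumFin b (λ _ → a) + sumFin b (degree G₂))
      ≡⟨ cong₂ _+_ (cong₂ _+_ (≡-sym (2·edgeCount≡Σdegree G₁)) (sumFin-const a b))
                   (cong₂ _+_ (sumFin-const b a) (≡-sym (2·edgeCount≡Σdegree G₂))) ⟩
  (e₁ + e₁ + a * b) + (b * a + (e₂ + e₂))                     ≡⟨ rearrange e₁ e₂ a b ⟩
  (e₁ + a * b + e₂) + (e₁ + a * b + e₂)                       ∎)
  where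
  open ≡-Reasoning
  open JoinAdjacency G₁ G₂
  J : Graph (a + b)
  J = join G₁ G₂
  e e₁ e₂ : ℕ
  e = edgeCount J
  e₁ = edgeCount G₁
  e₂ = edgeCount G₂
  rearrange : ∀ x z a b → (x + x + a * b) + (b * a + (z + z)) ≡ (x + a * b + z) + (x + a * b + z)
  rearrange = solve-∀ where open import Data.Nat.Tactic.RingSolver
  -- a vertex of G₁ gains the b vertices of G₂ as neighbours, and vice versa
  degree-left : ∀ i → degree J (i ↑ˡ b) ≡ degree G₁ i + b
  degree-left i = trans (countFin-+ a (adj J (i ↑ˡ b)))
    (cong₂ _+_ (countᵇ-cong (adj-ll i) (allFin a)) (trans (countᵇ-cong (adj-lr i) (allFin b)) (countFin-true b)))
  degree-right : ∀ j → degree J (a ↑ʳ j) ≡ a + degree G₂ j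
  degree-right j = trans (countFin-+ a (adj J (a ↑ʳ j)))
    (cong₂ _+_ (trans (countᵇ-cong (adj-rl j) (allFin a)) (countFin-true a)) (countᵇ-cong (adj-rr j) (allFin b)))

edgeCount-cong : ∀ {n} (G G' : Graph n) → (∀ i j → adj G i j ≡ adj G' i j) → edgeCount G ≡ edgeCount G'
edgeCount-cong {n} G G' h = countᵇ-cong (λ { (i , j) → cong ((toℕ i <ᵇ toℕ j) ∧_) (h i j) }) (allPairs n)

-- |E(K_{r+1})| = r + |E(K_r)|, since K_{r+1} = K_1 ∨ K_r.
edgeCount-complete-suc : ∀ r → edgeCount (complete (suc r)) ≡ r + edgeCount (complete r)
edgeCount-complete-suc r =
  trans (edgeCount-cong (complete (suc r)) (join (complete 1) (complete r)) same-adjacency)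
        (trans (edgeCount-join (complete 1) (complete r)) (cong (_+ edgeCount (complete r)) (NP.*-identityˡ r)))
  where
  same-adjacency : ∀ i j → adj (complete (suc r)) i j ≡ adj (join (complete 1) (complete r)) i j
  same-adjacency F.zero F.zero = refl
  same-adjacency F.zero (F.suc j) = refl
  same-adjacency (F.suc i) F.zero = refl
  same-adjacency (F.suc i) (F.suc j) = refl

<ᵇ⇒≢ᵇ : ∀ a b → (a <ᵇ b) ≡ true → (a ≡ᵇ b) ≡ false
<ᵇ⇒≢ᵇ zero (suc b) e = refl
<ᵇ⇒≢ᵇ (suc a) (suc b) e = <ᵇ⇒≢ᵇ a b e

edgeCount≤complete : ∀ {k} (H : Graph k) → edgeCount H ≤ edgeCount (complete k)
edgeCount≤complete {k} H = countᵇ-mono _ _ edge⇒complete-edge (allPairs k)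
  where
  edge⇒complete-edge : ∀ (p : Fin k × Fin k) →
    ((toℕ (proj₁ p) <ᵇ toℕ (proj₂ p)) ∧ adj H (proj₁ p) (proj₂ p)) ≡ true →
    ((toℕ (proj₁ p) <ᵇ toℕ (proj₂ p)) ∧ not (toℕ (proj₁ p) ≡ᵇ toℕ (proj₂ p))) ≡ true
  edge⇒complete-edge (i , j) e with ∧-true-inv {toℕ i <ᵇ toℕ j} e
  ... | lt , _ rewrite lt | <ᵇ⇒≢ᵇ (toℕ i) (toℕ j) lt = refl

addIsolated : ∀ {k} → Graph k → Graph (suc k)
addIsolated {k} G = record { adj = A ; sym = S ; irrefl = I }
  where
  A : Fin (suc k) → Fin (suc k) → Bool
  A F.zero _ = false
  A (F.suc i) F.zero = false
  A (F.suc i) (F.suc j) = adj G i j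
  S : ∀ i j → A i j ≡ A j i
  S F.zero F.zero = refl
  S F.zero (F.suc j) = refl
  S (F.suc i) F.zero = refl
  S (F.suc i) (F.suc j) = Graph.sym G i j
  I : ∀ i → A i i ≡ false
  I F.zero = refl
  I (F.suc i) = irrefl G i

edgeCount-addIsolated : ∀ {k} (G : Graph k) → edgeCount (addIsolated G) ≡ edgeCount G
edgeCount-addIsolated {k} G = double-injective _ _ (begin
  edgeCount G' + edgeCount G'                    ≡⟨ 2·edgeCount≡Σdegree G' ⟩
  sumFin (suc k) (degree G')                     ≡⟨ sumFin-suc k (degree G') ⟩
  degree G' F.zero + sumFin k (degree G' ∘ F.suc) ≡⟨ cong₂ _+_ (countᵇ-none _ (λ _ → refl) (allFin (suc k)))
                                                              (sumOver-cong (λ i → countᵇ-tabulate (adj G' (F.suc i)) F.suc) (allFin k)) ⟩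
  sumFin k (degree G)                            ≡⟨ ≡-sym (2·edgeCount≡Σdegree G) ⟩
  edgeCount G + edgeCount G                      ∎)
  where
  open ≡-Reasoning
  G' : Graph (suc k)
  G' = addIsolated G

emptyGraph : Graph 0
emptyGraph = record { adj = λ () ; sym = λ () ; irrefl = λ () }

-- Every e ≤ |E(K_k)| is the edge count of some graph on k vertices
-- (add a vertex adjacent to all others while e ≥ k − 1, an isolated one otherwise).
edgeCount-realisable : ∀ k e → e ≤ edgeCount (complete k) → Σ (Graph k) λ H → edgeCount H ≡ e
edgeCount-realisable zero e le rewrite NP.n≤0⇒n≡0 le = emptyGraph , refl
edgeCount-realisable (suc k) e le with k NP.≤? e
... | yes k≤e = join (complete 1) H , (begin
  edgeCount (join (complete 1) H)              ≡⟨ edgeCount-join (complete 1) H ⟩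
  edgeCount (complete 1) + 1 * k + edgeCount H ≡⟨ cong₂ _+_ (NP.*-identityˡ k) eH ⟩
  k + (e ∸ k)                                  ≡⟨ NP.m+[n∸m]≡n k≤e ⟩
  e                                            ∎)
  where
  open ≡-Reasoning
  rest≤ : e ∸ k ≤ edgeCount (complete k)
  rest≤ = subst (e ∸ k ≤_) (NP.m+n∸m≡n k (edgeCount (complete k)))
                (NP.∸-monoˡ-≤ k (subst (e ≤_) (edgeCount-complete-suc k) le))
  H : Graph k
  H = proj₁ (edgeCount-realisable k (e ∸ k) rest≤)
  eH : edgeCount H ≡ e ∸ k
  eH = proj₂ (edgeCount-realisable k (e ∸ k) rest≤)
... | no k≰e = addIsolated H , trans (edgeCount-addIsolated H) eH
  where
  e≤ : ∀ m → e < m → e ≤ edgeCount (complete m)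
  e≤ (suc j) (s≤s e≤j) = NP.≤-trans e≤j (subst (j ≤_) (≡-sym (edgeCount-complete-suc j)) (NP.m≤m+n j _))
  H : Graph k
  H = proj₁ (edgeCount-realisable k e (e≤ k (NP.≰⇒> k≰e)))
  eH : edgeCount H ≡ e
  eH = proj₂ (edgeCount-realisable k e (e≤ k (NP.≰⇒> k≰e)))

≡ᵇ-refl : ∀ a → (a ≡ᵇ a) ≡ true
≡ᵇ-refl zero = refl
≡ᵇ-refl (suc a) = ≡ᵇ-refl a

≡ᵇ-true⇒≡ : ∀ a b → (a ≡ᵇ b) ≡ true → a ≡ b
≡ᵇ-true⇒≡ zero zero e = refl
≡ᵇ-true⇒≡ (suc a) (suc b) e = cong suc (≡ᵇ-true⇒≡ a b e)

≢⇒≡ᵇ-false : ∀ a b → (a ≡ b → ⊥) → (a ≡ᵇ b) ≡ false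
≢⇒≡ᵇ-false a b ne with a ≡ᵇ b in e
... | true = ⊥-elim (ne (≡ᵇ-true⇒≡ a b e))
... | false = refl

adj-complete : ∀ {r} (i j : Fin r) → (i ≡ j → ⊥) → adj (complete r) i j ≡ true
adj-complete i j ne = cong not (≢⇒≡ᵇ-false (toℕ i) (toℕ j) (ne ∘ FP.toℕ-injective))

singleton : ∀ {n} → Fin n → VSet n
singleton {suc n} F.zero = true ∷ V.replicate n false
singleton {suc n} (F.suc i) = false ∷ singleton i

lookup-singleton : ∀ {n} (i j : Fin n) → lookup (singleton i) j ≡ (toℕ i ≡ᵇ toℕ j)
lookup-singleton F.zero F.zero = refl
lookup-singleton {suc n} F.zero (F.suc j) = VP.lookup-replicate j false
lookup-singleton (F.suc i) F.zero = refl
lookup-singleton (F.suc i) (F.suc j) = lookup-singleton i j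

isUniversal : ∀ {n} → Graph n → Fin n → Bool
isUniversal G i = isDominating G (singleton i)

universal⇒adj : ∀ {n} (G : Graph n) (i j : Fin n) → isUniversal G i ≡ true → (i ≡ j → ⊥) → adj G i j ≡ true
universal⇒adj {n} G i j U ne with all-elim _ (allFin n) U (∈P.∈-allFin j)
... | dominated rewrite lookup-singleton i j | ≢⇒≡ᵇ-false (toℕ i) (toℕ j) (ne ∘ FP.toℕ-injective)
  with any-elim _ (allFin n) dominated
... | w , q rewrite lookup-singleton i w with toℕ i ≡ᵇ toℕ w in r
... | true rewrite FP.toℕ-injective (≡ᵇ-true⇒≡ (toℕ i) (toℕ w) r) = q

adj⇒universal : ∀ {n} (G : Graph n) (i : Fin n) → (∀ j → (i ≡ j → ⊥) → adj G i j ≡ true) → isUniversal G i ≡ true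
adj⇒universal {n} G i h = all-intro _ (allFin n) dominated
  where
  dominated : ∀ v → (lookup (singleton i) v ∨ any (λ u → lookup (singleton i) u ∧ adj G u v) (allFin n)) ≡ true
  dominated v rewrite lookup-singleton i v with toℕ i ≡ᵇ toℕ v in r
  ... | true = refl
  ... | false = any-intro _ (allFin n) (∈P.∈-allFin i)
                  (cong₂ _∧_ (trans (lookup-singleton i i) (≡ᵇ-refl (toℕ i)))
                             (h v (λ e → true≢false (trans (≡-sym (≡ᵇ-refl (toℕ i))) (trans (cong (λ w → toℕ i ≡ᵇ toℕ w) e) r)))))
    where
    true≢false : true ≡ false → ⊥
    true≢false ()

countᵇ-size0 : ∀ n (P : VSet n → Bool) →
  countᵇ (λ S → P S ∧ (card S ≡ᵇ 0)) (allSubsets n) ≡ indicator (P (V.replicate n false))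
countᵇ-size0 zero P with P []
... | true = refl
... | false = refl
countᵇ-size0 (suc n) P = begin
  countᵇ Q (map (true ∷_) (allSubsets n) ++ map (false ∷_) (allSubsets n))
    ≡⟨ countᵇ-++ Q (map (true ∷_) (allSubsets n)) (map (false ∷_) (allSubsets n)) ⟩
  countᵇ Q (map (true ∷_) (allSubsets n)) + countᵇ Q (map (false ∷_) (allSubsets n))
    ≡⟨ cong₂ _+_ (trans (countᵇ-map Q (true ∷_) (allSubsets n)) (countᵇ-none _ (λ S → BP.∧-zeroʳ (P (true ∷ S))) (allSubsets n)))
                 (trans (countᵇ-map Q (false ∷_) (allSubsets n)) (countᵇ-size0 n (P ∘ (false ∷_)))) ⟩
  indicator (P (V.replicate (suc n) false)) ∎
  where
  open ≡-Reasoning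
  Q : VSet (suc n) → Bool
  Q S = P S ∧ (card S ≡ᵇ 0)

countᵇ-size1 : ∀ n (P : VSet n → Bool) →
  countᵇ (λ S → P S ∧ (card S ≡ᵇ 1)) (allSubsets n) ≡ countᵇ (P ∘ singleton) (allFin n)
countᵇ-size1 zero P = countᵇ-none (λ S → P S ∧ (card S ≡ᵇ 1)) (λ { [] → BP.∧-zeroʳ (P []) }) (allSubsets zero)
countᵇ-size1 (suc n) P = begin
  countᵇ Q (map (true ∷_) (allSubsets n) ++ map (false ∷_) (allSubsets n))
    ≡⟨ countᵇ-++ Q (map (true ∷_) (allSubsets n)) (map (false ∷_) (allSubsets n)) ⟩
  countᵇ Q (map (true ∷_) (allSubsets n)) + countᵇ Q (map (false ∷_) (allSubsets n))
    ≡⟨ cong₂ _+_ (trans (countᵇ-map Q (true ∷_) (allSubsets n)) (countᵇ-size0 n (P ∘ (true ∷_))))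
                 (trans (countᵇ-map Q (false ∷_) (allSubsets n)) (countᵇ-size1 n (P ∘ (false ∷_)))) ⟩
  indicator (P (singleton F.zero)) + countᵇ (P ∘ singleton ∘ F.suc) (allFin n)
    ≡⟨ first-and-rest ⟩
  countᵇ (P ∘ singleton) (allFin (suc n)) ∎
  where
  open ≡-Reasoning
  Q : VSet (suc n) → Bool
  Q S = P S ∧ (card S ≡ᵇ 1)
  first-and-rest : indicator (P (singleton F.zero)) + countᵇ (P ∘ singleton ∘ F.suc) (allFin n)
                 ≡ countᵇ (P ∘ singleton) (allFin (suc n))
  first-and-rest with P (singleton F.zero)
  ... | true = cong suc (≡-sym (countᵇ-tabulate (P ∘ singleton) F.suc))
  ... | false = ≡-sym (countᵇ-tabulate (P ∘ singleton) F.suc)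

domCount1≡#universal : ∀ {n} (G : Graph n) → domCount G 1 ≡ countᵇ (isUniversal G) (allFin n)
domCount1≡#universal {n} G = countᵇ-size1 n (isDominating G)

-- The vertices of K_a are universal in K_a ∨ H, so K_a ∨ H has at least a universal vertices.
a≤#universal-join : ∀ a {b} (H : Graph b) → a ≤ domCount (join (complete a) H) 1
a≤#universal-join a {b} H = begin
  a                                                 ≡⟨ ≡-sym (countFin-true a) ⟩
  countᵇ (λ _ → true) (allFin a)                    ≡⟨ countᵇ-cong (λ x → ≡-sym (left-universal x)) (allFin a) ⟩
  countᵇ (isUniversal J ∘ (_↑ˡ b)) (allFin a)        ≤⟨ NP.m≤m+n _ _ ⟩
  countᵇ (isUniversal J ∘ (_↑ˡ b)) (allFin a) + countᵇ (isUniversal J ∘ (a ↑ʳ_)) (allFin b)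
                                                    ≡⟨ ≡-sym (countFin-+ a (isUniversal J)) ⟩
  countᵇ (isUniversal J) (allFin (a + b))           ≡⟨ ≡-sym (domCount1≡#universal J) ⟩
  domCount J 1                                      ∎
  where
  open NP.≤-Reasoning
  open JoinAdjacency (complete a) H
  J : Graph (a + b)
  J = join (complete a) H
  left-universal : ∀ x → isUniversal J (x ↑ˡ b) ≡ true
  left-universal x = adj⇒universal J (x ↑ˡ b) adjacent
    where
    adjacent : ∀ j → (x ↑ˡ b ≡ j → ⊥) → adj J (x ↑ˡ b) j ≡ true
    adjacent j ne rewrite adj-join (x ↑ˡ b) j | FP.splitAt-↑ˡ a x b with splitAt a j in e
    ... | inj₂ y = refl
    ... | inj₁ y = adj-complete x y (λ x≡y → ne (trans (cong (_↑ˡ b) x≡y)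
                      (trans (cong (F.join a b) (≡-sym e)) (FP.join-splitAt a b j))))

-- Fin n is in bijection with Fin (#true n u) ⊎ Fin (#false n u), preserving the order
-- inside each block; the bijection is built one vertex at a time.
sucIf : Bool → ℕ → ℕ
sucIf true c = suc c
sucIf false c = c

#true : (n : ℕ) → (Fin n → Bool) → ℕ
#true zero u = 0
#true (suc n) u = sucIf (u F.zero) (#true n (u ∘ F.suc))

#false : (n : ℕ) → (Fin n → Bool) → ℕ
#false zero u = 0
#false (suc n) u = sucIf (not (u F.zero)) (#false n (u ∘ F.suc))

stepPartition : ∀ {n a c} (b : Bool) → (Fin n → Fin a ⊎ Fin c) → Fin (suc n) → Fin (sucIf b a) ⊎ Fin (sucIf (not b) c)
stepPartition true f F.zero = inj₁ F.zero
stepPartition false f F.zero = inj₂ F.zero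
stepPartition true f (F.suc i) with f i
... | inj₁ x = inj₁ (F.suc x)
... | inj₂ y = inj₂ y
stepPartition false f (F.suc i) with f i
... | inj₁ x = inj₁ x
... | inj₂ y = inj₂ (F.suc y)

stepUnpartition : ∀ {n a c} (b : Bool) → (Fin a ⊎ Fin c → Fin n) → Fin (sucIf b a) ⊎ Fin (sucIf (not b) c) → Fin (suc n)
stepUnpartition true g (inj₁ F.zero) = F.zero
stepUnpartition true g (inj₁ (F.suc x)) = F.suc (g (inj₁ x))
stepUnpartition true g (inj₂ y) = F.suc (g (inj₂ y))
stepUnpartition false g (inj₁ x) = F.suc (g (inj₁ x))
stepUnpartition false g (inj₂ F.zero) = F.zero
stepUnpartition false g (inj₂ (F.suc y)) = F.suc (g (inj₂ y))

partition : (n : ℕ) (u : Fin n → Bool) → Fin n → Fin (#true n u) ⊎ Fin (#false n u)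
partition (suc n) u = stepPartition (u F.zero) (partition n (u ∘ F.suc))

unpartition : (n : ℕ) (u : Fin n → Bool) → Fin (#true n u) ⊎ Fin (#false n u) → Fin n
unpartition zero u (inj₁ ())
unpartition zero u (inj₂ ())
unpartition (suc n) u = stepUnpartition (u F.zero) (unpartition n (u ∘ F.suc))

unpartition-partition : ∀ n u i → unpartition n u (partition n u i) ≡ i
unpartition-partition (suc n) u i = go (u F.zero) i
  where
  ih : ∀ i → unpartition n (u ∘ F.suc) (partition n (u ∘ F.suc) i) ≡ i
  ih = unpartition-partition n (u ∘ F.suc)
  go : (b : Bool) (i : Fin (suc n)) → stepUnpartition b (unpartition n (u ∘ F.suc)) (stepPartition b (partition n (u ∘ F.suc)) i) ≡ i
  go true F.zero = refl
  go false F.zero = refl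
  go true (F.suc i) with partition n (u ∘ F.suc) i in eq
  ... | inj₁ x = cong F.suc (trans (cong (unpartition n (u ∘ F.suc)) (≡-sym eq)) (ih i))
  ... | inj₂ y = cong F.suc (trans (cong (unpartition n (u ∘ F.suc)) (≡-sym eq)) (ih i))
  go false (F.suc i) with partition n (u ∘ F.suc) i in eq
  ... | inj₁ x = cong F.suc (trans (cong (unpartition n (u ∘ F.suc)) (≡-sym eq)) (ih i))
  ... | inj₂ y = cong F.suc (trans (cong (unpartition n (u ∘ F.suc)) (≡-sym eq)) (ih i))

partition-unpartition : ∀ n u s → partition n u (unpartition n u s) ≡ s
partition-unpartition zero u (inj₁ ())
partition-unpartition zero u (inj₂ ())
partition-unpartition (suc n) u s = go (u F.zero) s
  where
  ih : ∀ s → partition n (u ∘ F.suc) (unpartition n (u ∘ F.suc) s) ≡ s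
  ih = partition-unpartition n (u ∘ F.suc)
  go : (b : Bool) (s : Fin (sucIf b (#true n (u ∘ F.suc))) ⊎ Fin (sucIf (not b) (#false n (u ∘ F.suc)))) →
       stepPartition b (partition n (u ∘ F.suc)) (stepUnpartition b (unpartition n (u ∘ F.suc)) s) ≡ s
  go true (inj₁ F.zero) = refl
  go true (inj₁ (F.suc x)) rewrite ih (inj₁ x) = refl
  go true (inj₂ y) rewrite ih (inj₂ y) = refl
  go false (inj₁ x) rewrite ih (inj₁ x) = refl
  go false (inj₂ F.zero) = refl
  go false (inj₂ (F.suc y)) rewrite ih (inj₂ y) = refl

isLeft : {A B : Set} → A ⊎ B → Bool
isLeft (inj₁ _) = true
isLeft (inj₂ _) = false

partition-isLeft : ∀ n u i → isLeft (partition n u i) ≡ u i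
partition-isLeft (suc n) u i = go (u F.zero) refl i
  where
  go : (b : Bool) → u F.zero ≡ b → (i : Fin (suc n)) → isLeft (stepPartition b (partition n (u ∘ F.suc)) i) ≡ u i
  go true e F.zero = ≡-sym e
  go false e F.zero = ≡-sym e
  go true e (F.suc i) with partition n (u ∘ F.suc) i | partition-isLeft n (u ∘ F.suc) i
  ... | inj₁ x | r = r
  ... | inj₂ y | r = r
  go false e (F.suc i) with partition n (u ∘ F.suc) i | partition-isLeft n (u ∘ F.suc) i
  ... | inj₁ x | r = r
  ... | inj₂ y | r = r

#true≡countᵇ : ∀ n u → #true n u ≡ countᵇ u (allFin n)
#true≡countᵇ zero u = refl
#true≡countᵇ (suc n) u with u F.zero
... | true = cong suc (trans (#true≡countᵇ n (u ∘ F.suc)) (≡-sym (countᵇ-tabulate u F.suc)))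
... | false = trans (#true≡countᵇ n (u ∘ F.suc)) (≡-sym (countᵇ-tabulate u F.suc))

induced : ∀ {n k} → Graph n → (Fin k → Fin n) → Graph k
induced G ι = record
  { adj = λ x y → adj G (ι x) (ι y)
  ; sym = λ x y → Graph.sym G (ι x) (ι y)
  ; irrefl = λ x → irrefl G (ι x) }

record UniversalDecomposition {n : ℕ} (G : Graph n) : Set where
  field
    r k        : ℕ
    rest       : Graph k
    iso        : G ≅ join (complete r) rest
    #universal : domCount G 1 ≡ r

-- Put the universal vertices first; they are adjacent to everything, so G ≅ K_r ∨ H
-- where H is induced on the remaining vertices.
universalDecomposition : ∀ {n} (G : Graph n) → UniversalDecomposition G
universalDecomposition {n} G = record
  { r = r ; k = k ; rest = H ; iso = σ , preserves
  ; #universal = trans (domCount1≡#universal G) (≡-sym (#true≡countᵇ n u)) }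
  where
  u : Fin n → Bool
  u = isUniversal G
  r k : ℕ
  r = #true n u
  k = #false n u
  split : Fin n → Fin r ⊎ Fin k
  split = partition n u
  unsplit : Fin r ⊎ Fin k → Fin n
  unsplit = unpartition n u
  H : Graph k
  H = induced G (unsplit ∘ inj₂)
  σ : Fin n ↔ Fin (r + k)
  σ = mk↔ₛ′ (F.join r k ∘ split) (unsplit ∘ splitAt r)
        (λ j → trans (cong (F.join r k) (partition-unpartition n u (splitAt r j))) (FP.join-splitAt r k j))
        (λ i → trans (cong unsplit (FP.splitAt-join r k (split i))) (unpartition-partition n u i))

  open JoinAdjacency (complete r) H

  unsplit-split : ∀ i {s} → split i ≡ s → unsplit s ≡ i
  unsplit-split i e = trans (cong unsplit (≡-sym e)) (unpartition-partition n u i)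
  left⇒universal : ∀ i {x} → split i ≡ inj₁ x → isUniversal G i ≡ true
  left⇒universal i e = trans (≡-sym (partition-isLeft n u i)) (cong isLeft e)
  left≢right : ∀ i j {x y} → split i ≡ inj₁ x → split j ≡ inj₂ y → i ≡ j → ⊥
  left≢right i j ei ej refl with trans (≡-sym ei) ej
  ... | ()

  on-blocks : ∀ i j → joinAdj (split i) (split j) ≡ adj G i j
  on-blocks i j with split i in ei | split j in ej
  ... | inj₁ x | inj₁ y with i FP.≟ j
  ...   | yes refl with trans (≡-sym ei) ej
  ...     | refl = trans (irrefl (complete r) x) (≡-sym (irrefl G i))
  on-blocks i j | inj₁ x | inj₁ y | no i≢j =
    trans (adj-complete x y (λ x≡y → i≢j (trans (≡-sym (unsplit-split i ei)) (trans (cong (unsplit ∘ inj₁) x≡y) (unsplit-split j ej)))))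
          (≡-sym (universal⇒adj G i j (left⇒universal i ei) i≢j))
  on-blocks i j | inj₁ x | inj₂ y = ≡-sym (universal⇒adj G i j (left⇒universal i ei) (left≢right i j ei ej))
  on-blocks i j | inj₂ x | inj₁ y =
    ≡-sym (trans (Graph.sym G i j) (universal⇒adj G j i (left⇒universal j ej) (left≢right j i ej ei)))
  on-blocks i j | inj₂ x | inj₂ y = cong₂ (adj G) (unsplit-split i ei) (unsplit-split j ej)

  preserves : ∀ i j → adj (join (complete r) H) (F.join r k (split i)) (F.join r k (split j)) ≡ adj G i j
  preserves i j = trans (adj-join _ _)
    (trans (cong₂ joinAdj (FP.splitAt-join r k (split i)) (FP.splitAt-join r k (split j))) (on-blocks i j))

nonempty : ∀ {n} → VSet n → Bool
nonempty {n} S = any (lookup S) (allFin n)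

nonempty-∷ : ∀ {n} b (S : VSet n) → nonempty (b ∷ S) ≡ (b ∨ nonempty S)
nonempty-∷ b S = cong (b ∨_) (any-tabulate (lookup (b ∷ S)) F.suc)

empty⇒card≡0 : ∀ {n} (S : VSet n) → nonempty S ≡ false → card S ≡ 0
empty⇒card≡0 {n} S e = trans (card≡countᵇ S) (any-false⇒countᵇ≡0 (lookup S) (allFin n) e)

card≥1⇒nonempty : ∀ {n} (S : VSet n) → 1 ≤ card S → nonempty S ≡ true
card≥1⇒nonempty S le with nonempty S in e
... | true = refl
... | false with subst (1 ≤_) (empty⇒card≡0 S e) le
... | ()

card-++ : ∀ {a b} (S₁ : VSet a) (S₂ : VSet b) → card (S₁ V.++ S₂) ≡ card S₁ + card S₂
card-++ [] S₂ = refl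
card-++ (true ∷ S₁) S₂ = cong suc (card-++ S₁ S₂)
card-++ (false ∷ S₁) S₂ = card-++ S₁ S₂

countᵇ-subsets-+ : ∀ r k (p : VSet (r + k) → Bool) →
  countᵇ p (allSubsets (r + k)) ≡ sumOver (λ S₁ → countᵇ (λ S₂ → p (S₁ V.++ S₂)) (allSubsets k)) (allSubsets r)
countᵇ-subsets-+ zero k p = ≡-sym (NP.+-identityʳ _)
countᵇ-subsets-+ (suc r) k p = begin
  countᵇ p (map (true ∷_) (allSubsets (r + k)) ++ map (false ∷_) (allSubsets (r + k)))
    ≡⟨ countᵇ-++ p (map (true ∷_) (allSubsets (r + k))) (map (false ∷_) (allSubsets (r + k))) ⟩
  countᵇ p (map (true ∷_) (allSubsets (r + k))) + countᵇ p (map (false ∷_) (allSubsets (r + k)))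
    ≡⟨ cong₂ _+_ (trans (countᵇ-map p (true ∷_) (allSubsets (r + k))) (countᵇ-subsets-+ r k (p ∘ (true ∷_))))
                 (trans (countᵇ-map p (false ∷_) (allSubsets (r + k))) (countᵇ-subsets-+ r k (p ∘ (false ∷_)))) ⟩
  sumOver (f ∘ (true ∷_)) (allSubsets r) + sumOver (f ∘ (false ∷_)) (allSubsets r)
    ≡⟨ ≡-sym (cong₂ _+_ (sumOver-map f (true ∷_) (allSubsets r)) (sumOver-map f (false ∷_) (allSubsets r))) ⟩
  sumOver f (map (true ∷_) (allSubsets r)) + sumOver f (map (false ∷_) (allSubsets r))
    ≡⟨ ≡-sym (sumOver-++ f (map (true ∷_) (allSubsets r)) (map (false ∷_) (allSubsets r))) ⟩
  sumOver f (allSubsets (suc r)) ∎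
  where
  open ≡-Reasoning
  f : VSet (suc r) → ℕ
  f S₁ = countᵇ (λ S₂ → p (S₁ V.++ S₂)) (allSubsets k)

sumOver-empty : ∀ r c → sumOver (λ S → if nonempty S then 0 else c) (allSubsets r) ≡ c
sumOver-empty zero c = NP.+-identityʳ c
sumOver-empty (suc r) c = begin
  sumOver g (map (true ∷_) (allSubsets r) ++ map (false ∷_) (allSubsets r))
    ≡⟨ sumOver-++ g (map (true ∷_) (allSubsets r)) (map (false ∷_) (allSubsets r)) ⟩
  sumOver g (map (true ∷_) (allSubsets r)) + sumOver g (map (false ∷_) (allSubsets r))
    ≡⟨ cong₂ _+_ (trans (sumOver-map g (true ∷_) (allSubsets r))
                        (trans (sumOver-cong (λ S → cong (λ b → if b then 0 else c) (nonempty-∷ true S)) (allSubsets r))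
                               (sumOver-zero (allSubsets r))))
                 (trans (sumOver-map g (false ∷_) (allSubsets r))
                        (trans (sumOver-cong (λ S → cong (λ b → if b then 0 else c) (nonempty-∷ false S)) (allSubsets r))
                               (sumOver-empty r c))) ⟩
  c ∎
  where
  open ≡-Reasoning
  g : VSet (suc r) → ℕ
  g S = if nonempty S then 0 else c

module DominationInJoin {r k : ℕ} (H : Graph k) (S₁ : VSet r) (S₂ : VSet k) where
  J : Graph (r + k)
  J = join (complete r) H
  S : VSet (r + k)
  S = S₁ V.++ S₂
  open JoinAdjacency (complete r) H

  dominatedJ : Fin (r + k) → Bool
  dominatedJ v = lookup S v ∨ any (λ u → lookup S u ∧ adj J u v) (allFin (r + k))

  dominated-left : ∀ x → dominatedJ (x ↑ˡ k)
    ≡ (lookup S₁ x ∨ (any (λ x' → lookup S₁ x' ∧ adj (complete r) x' x) (allFin r) ∨ nonempty S₂))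
  dominated-left x = cong₂ _∨_ (VP.lookup-++ˡ S₁ S₂ x) (trans (anyFin-+ r (λ u → lookup S u ∧ adj J u (x ↑ˡ k)))
    (cong₂ _∨_ (any-cong (λ x' → cong₂ _∧_ (VP.lookup-++ˡ S₁ S₂ x') (adj-ll x' x)) (allFin r))
               (any-cong (λ y' → trans (cong₂ _∧_ (VP.lookup-++ʳ S₁ S₂ y') (adj-rl y' x)) (BP.∧-identityʳ _)) (allFin k))))

  dominated-right : ∀ y → dominatedJ (r ↑ʳ y)
    ≡ (lookup S₂ y ∨ (nonempty S₁ ∨ any (λ y' → lookup S₂ y' ∧ adj H y' y) (allFin k)))
  dominated-right y = cong₂ _∨_ (VP.lookup-++ʳ S₁ S₂ y) (trans (anyFin-+ r (λ u → lookup S u ∧ adj J u (r ↑ʳ y)))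
    (cong₂ _∨_ (any-cong (λ x' → trans (cong₂ _∧_ (VP.lookup-++ˡ S₁ S₂ x') (adj-lr x' y)) (BP.∧-identityʳ _)) (allFin r))
               (any-cong (λ y' → cong₂ _∧_ (VP.lookup-++ʳ S₁ S₂ y') (adj-rr y' y)) (allFin k))))

  meets-K⇒dominating : nonempty S₁ ≡ true → isDominating J S ≡ true
  meets-K⇒dominating e = trans (allFin-+ r dominatedJ) (cong₂ _∧_ (all-intro _ (allFin r) left) (all-intro _ (allFin k) right))
    where
    x₀ : Fin r
    x₀ = proj₁ (any-elim (lookup S₁) (allFin r) e)
    x₀∈S₁ : lookup S₁ x₀ ≡ true
    x₀∈S₁ = proj₂ (any-elim (lookup S₁) (allFin r) e)
    right : ∀ y → dominatedJ (r ↑ʳ y) ≡ true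
    right y rewrite dominated-right y | e = BP.∨-zeroʳ (lookup S₂ y)
    left : ∀ x → dominatedJ (x ↑ˡ k) ≡ true
    left x rewrite dominated-left x with x₀ FP.≟ x
    ... | yes refl rewrite x₀∈S₁ = refl
    ... | no x₀≢x rewrite any-intro (λ x' → lookup S₁ x' ∧ adj (complete r) x' x) (allFin r) (∈P.∈-allFin x₀)
                            (cong₂ _∧_ x₀∈S₁ (adj-complete x₀ x x₀≢x))
                = BP.∨-zeroʳ (lookup S₁ x)

  avoids-K⇒dominating : nonempty S₁ ≡ false → isDominating J S ≡ (all (λ _ → nonempty S₂) (allFin r) ∧ isDominating H S₂)
  avoids-K⇒dominating e = trans (allFin-+ r dominatedJ) (cong₂ _∧_ (all-cong left (allFin r)) (all-cong right (allFin k)))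
    where
    S₁-empty : ∀ x → lookup S₁ x ≡ false
    S₁-empty x = any-false-elim (lookup S₁) (allFin r) e (∈P.∈-allFin x)
    left : ∀ x → dominatedJ (x ↑ˡ k) ≡ nonempty S₂
    left x rewrite dominated-left x | S₁-empty x
                 | any-false-intro (λ x' → lookup S₁ x' ∧ adj (complete r) x' x) (allFin r) (λ x' → cong (_∧ adj (complete r) x' x) (S₁-empty x'))
                 = refl
    right : ∀ y → dominatedJ (r ↑ʳ y) ≡ (lookup S₂ y ∨ any (λ y' → lookup S₂ y' ∧ adj H y' y) (allFin k))
    right y rewrite dominated-right y | e = refl

meetingCount : ℕ → ℕ → ℕ → ℕ
meetingCount r k i =
  sumOver (λ S₁ → if nonempty S₁ then countᵇ (λ S₂ → (card S₁ + card S₂) ≡ᵇ i) (allSubsets k) else 0) (allSubsets r)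

domCount-join : ∀ r {k} (H : Graph k) i → 1 ≤ i → domCount (join (complete r) H) i ≡ meetingCount r k i + domCount H i
domCount-join r {k} H i 1≤i = begin
  domCount J i                                    ≡⟨ countᵇ-subsets-+ r k (λ S → isDominating J S ∧ (card S ≡ᵇ i)) ⟩
  sumOver f (allSubsets r)                        ≡⟨ sumOver-cong by-S₁ (allSubsets r) ⟩
  sumOver (λ S₁ → meeting S₁ + avoiding S₁) (allSubsets r) ≡⟨ sumOver-+ meeting avoiding (allSubsets r) ⟩
  meetingCount r k i + sumOver avoiding (allSubsets r) ≡⟨ cong (meetingCount r k i +_) (sumOver-empty r (domCount H i)) ⟩
  meetingCount r k i + domCount H i               ∎
  where
  open ≡-Reasoning
  J : Graph (r + k)
  J = join (complete r) H
  f meeting avoiding : VSet r → ℕ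
  f S₁ = countᵇ (λ S₂ → isDominating J (S₁ V.++ S₂) ∧ (card (S₁ V.++ S₂) ≡ᵇ i)) (allSubsets k)
  meeting S₁ = if nonempty S₁ then countᵇ (λ S₂ → (card S₁ + card S₂) ≡ᵇ i) (allSubsets k) else 0
  avoiding S₁ = if nonempty S₁ then 0 else domCount H i
  by-S₁ : ∀ S₁ → f S₁ ≡ meeting S₁ + avoiding S₁
  by-S₁ S₁ with nonempty S₁ in e
  ... | true = trans (countᵇ-cong (λ S₂ → cong₂ _∧_ (DominationInJoin.meets-K⇒dominating H S₁ S₂ e) (cong (_≡ᵇ i) (card-++ S₁ S₂)))
                                  (allSubsets k))
                     (≡-sym (NP.+-identityʳ _))
  ... | false = countᵇ-cong same (allSubsets k)
    where
    -- with S₁ = ∅, an i-set (i ≥ 1) is nonempty, so the condition on K_r is automatic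
    same : ∀ S₂ → (isDominating J (S₁ V.++ S₂) ∧ (card (S₁ V.++ S₂) ≡ᵇ i)) ≡ (isDominating H S₂ ∧ (card S₂ ≡ᵇ i))
    same S₂ rewrite DominationInJoin.avoids-K⇒dominating H S₁ S₂ e | card-++ S₁ S₂ | empty⇒card≡0 S₁ e
      with card S₂ ≡ᵇ i in c
    ... | true rewrite all-intro (λ _ → nonempty S₂) (allFin r)
                         (λ _ → card≥1⇒nonempty S₂ (subst (1 ≤_) (≡-sym (≡ᵇ-true⇒≡ (card S₂) i c)) 1≤i)) = refl
    ... | false rewrite BP.∧-zeroʳ (all (λ _ → nonempty S₂) (allFin r) ∧ isDominating H S₂)
                      | BP.∧-zeroʳ (isDominating H S₂) = refl

card≤ : ∀ {n} (S : VSet n) → card S ≤ n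
card≤ [] = z≤n
card≤ (true ∷ S) = s≤s (card≤ S)
card≤ (false ∷ S) = NP.m≤n⇒m≤1+n (card≤ S)

domCount-beyond : ∀ {k} (H : Graph k) i → k < i → domCount H i ≡ 0
domCount-beyond {k} H i k<i = countᵇ-none _ no-such-set (allSubsets k)
  where
  no-such-set : ∀ S → (isDominating H S ∧ (card S ≡ᵇ i)) ≡ false
  no-such-set S = trans (cong (isDominating H S ∧_) (≢⇒≡ᵇ-false (card S) i (λ e → NP.<-irrefl e (NP.≤-<-trans (card≤ S) k<i))))
                        (BP.∧-zeroʳ _)

sumFrom1-+ : ∀ N (f g : ℕ → ℚ) → sumFrom1 N (λ i → f i ℚ.+ g i) ≡ sumFrom1 N f ℚ.+ sumFrom1 N g
sumFrom1-+ zero f g = ≡-sym (QP.+-identityʳ 0ℚ)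
sumFrom1-+ (suc N) f g =
  trans (cong (ℚ._+ (f (suc N) ℚ.+ g (suc N))) (sumFrom1-+ N f g)) (interchange (sumFrom1 N f) (sumFrom1 N g) (f (suc N)) (g (suc N)))
  where
  open import Data.Rational.Solver using (module +-*-Solver)
  open +-*-Solver
  interchange : ∀ a b c d → (a ℚ.+ b) ℚ.+ (c ℚ.+ d) ≡ (a ℚ.+ c) ℚ.+ (b ℚ.+ d)
  interchange = solve 4 (λ a b c d → (a :+ b) :+ (c :+ d) := (a :+ c) :+ (b :+ d)) refl

sumFrom1-beyond : ∀ k (f : ℕ → ℚ) → (∀ i → k < i → f i ≡ 0ℚ) → ∀ j → sumFrom1 (j + k) f ≡ sumFrom1 k f
sumFrom1-beyond k f h zero = refl
sumFrom1-beyond k f h (suc j) =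
  trans (cong₂ ℚ._+_ (sumFrom1-beyond k f h j) (h (suc (j + k)) (s≤s (NP.m≤n+m k j)))) (QP.+-identityʳ _)

meetingPoly : ℕ → ℕ → ℚ → ℚ
meetingPoly r k x = sumFrom1 (r + k) (λ i → coeff (meetingCount r k i) ℚ.* (x ^ℚ i))

domPoly-join : ∀ r {k} (H : Graph k) x → domPoly (join (complete r) H) x ≡ meetingPoly r k x ℚ.+ domPoly H x
domPoly-join r {k} H x = begin
  domPoly (join (complete r) H) x
    ≡⟨ sumFrom1-cong (r + k) coefficientwise ⟩
  sumFrom1 (r + k) (λ i → coeff (meetingCount r k i) ℚ.* (x ^ℚ i) ℚ.+ term i)
    ≡⟨ sumFrom1-+ (r + k) (λ i → coeff (meetingCount r k i) ℚ.* (x ^ℚ i)) term ⟩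
  meetingPoly r k x ℚ.+ sumFrom1 (r + k) term
    ≡⟨ cong (meetingPoly r k x ℚ.+_) (sumFrom1-beyond k term vanishes r) ⟩
  meetingPoly r k x ℚ.+ domPoly H x ∎
  where
  open ≡-Reasoning
  term : ℕ → ℚ
  term i = coeff (domCount H i) ℚ.* (x ^ℚ i)
  coefficientwise : ∀ i → coeff (domCount (join (complete r) H) (suc i)) ℚ.* (x ^ℚ suc i)
                        ≡ coeff (meetingCount r k (suc i)) ℚ.* (x ^ℚ suc i) ℚ.+ term (suc i)
  coefficientwise i = begin
    coeff (domCount (join (complete r) H) (suc i)) ℚ.* (x ^ℚ suc i)
      ≡⟨ cong (λ d → coeff d ℚ.* (x ^ℚ suc i)) (domCount-join r H (suc i) (s≤s z≤n)) ⟩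
    coeff (meetingCount r k (suc i) + domCount H (suc i)) ℚ.* (x ^ℚ suc i)
      ≡⟨ cong (ℚ._* (x ^ℚ suc i)) (coeff-+ (meetingCount r k (suc i)) (domCount H (suc i))) ⟩
    (coeff (meetingCount r k (suc i)) ℚ.+ coeff (domCount H (suc i))) ℚ.* (x ^ℚ suc i)
      ≡⟨ QP.*-distribʳ-+ (x ^ℚ suc i) (coeff (meetingCount r k (suc i))) (coeff (domCount H (suc i))) ⟩
    coeff (meetingCount r k (suc i)) ℚ.* (x ^ℚ suc i) ℚ.+ term (suc i) ∎
  vanishes : ∀ i → k < i → term i ≡ 0ℚ
  vanishes i k<i = trans (cong (λ d → coeff d ℚ.* (x ^ℚ i)) (domCount-beyond H i k<i)) (QP.*-zeroˡ (x ^ℚ i))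

0≤1 : 0ℚ ℚ.≤ 1ℚ
0≤1 = QP.nonNegative⁻¹ 1ℚ

*-nonneg : ∀ p q → 0ℚ ℚ.≤ p → 0ℚ ℚ.≤ q → 0ℚ ℚ.≤ p ℚ.* q
*-nonneg p q hp hq = QP.nonNegative⁻¹ _ {{QP.nonNeg*nonNeg⇒nonNeg p {{ℚ.nonNegative hp}} q {{ℚ.nonNegative hq}}}}

^-nonneg : ∀ x → 0ℚ ℚ.≤ x → ∀ i → 0ℚ ℚ.≤ x ^ℚ i
^-nonneg x h zero = 0≤1
^-nonneg x h (suc i) = *-nonneg x (x ^ℚ i) h (^-nonneg x h i)

^-≤-square : ∀ x → 0ℚ ℚ.≤ x → x ℚ.≤ 1ℚ → ∀ j → x ^ℚ (2 + j) ℚ.≤ x ℚ.* x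
^-≤-square x 0≤x x≤1 zero = QP.≤-reflexive (cong (x ℚ.*_) (QP.*-identityʳ x))
^-≤-square x 0≤x x≤1 (suc j) = begin
  x ℚ.* x ^ℚ (2 + j)  ≤⟨ QP.*-monoʳ-≤-nonNeg (x ^ℚ (2 + j)) {{ℚ.nonNegative (^-nonneg x 0≤x (2 + j))}} x≤1 ⟩
  1ℚ ℚ.* x ^ℚ (2 + j) ≡⟨ QP.*-identityˡ _ ⟩
  x ^ℚ (2 + j)        ≤⟨ ^-≤-square x 0≤x x≤1 j ⟩
  x ℚ.* x             ∎
  where open QP.≤-Reasoning

sumFrom1-nonneg : ∀ (f : ℕ → ℚ) → (∀ i → 0ℚ ℚ.≤ f i) → ∀ m → 0ℚ ℚ.≤ sumFrom1 m f
sumFrom1-nonneg f h zero = QP.≤-refl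
sumFrom1-nonneg f h (suc m) = QP.≤-trans (QP.≤-reflexive (≡-sym (QP.+-identityʳ 0ℚ))) (QP.+-mono-≤ (sumFrom1-nonneg f h m) (h (suc m)))

≤-+-nonneg : ∀ p q → 0ℚ ℚ.≤ q → p ℚ.≤ p ℚ.+ q
≤-+-nonneg p q h = QP.≤-trans (QP.≤-reflexive (≡-sym (QP.+-identityʳ p))) (QP.+-monoʳ-≤ p h)

sumFrom1-upper : (c : ℕ → ℚ) → (∀ i → 0ℚ ℚ.≤ c i) → ∀ x → 0ℚ ℚ.≤ x → x ℚ.≤ 1ℚ → ∀ m →
  sumFrom1 (suc m) (λ i → c i ℚ.* x ^ℚ i) ℚ.≤ c 1 ℚ.* x ℚ.+ sumFrom1 (suc m) c ℚ.* (x ℚ.* x)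
sumFrom1-upper c c≥0 x 0≤x x≤1 zero = begin
  0ℚ ℚ.+ c 1 ℚ.* (x ℚ.* 1ℚ) ≡⟨ linear (c 1) x ⟩
  c 1 ℚ.* x                 ≤⟨ ≤-+-nonneg _ _ (*-nonneg _ _ (sumFrom1-nonneg c c≥0 1) (*-nonneg x x 0≤x 0≤x)) ⟩
  c 1 ℚ.* x ℚ.+ sumFrom1 1 c ℚ.* (x ℚ.* x) ∎
  where
  open QP.≤-Reasoning
  open import Data.Rational.Solver using (module +-*-Solver)
  open +-*-Solver
  linear : ∀ a y → 0ℚ ℚ.+ a ℚ.* (y ℚ.* 1ℚ) ≡ a ℚ.* y
  linear = solve 2 (λ a y → con 0ℚ :+ a :* (y :* con 1ℚ) := a :* y) refl
sumFrom1-upper c c≥0 x 0≤x x≤1 (suc m) = begin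
  sumFrom1 (suc m) (λ i → c i ℚ.* x ^ℚ i) ℚ.+ c (2 + m) ℚ.* x ^ℚ (2 + m)
    ≤⟨ QP.+-mono-≤ (sumFrom1-upper c c≥0 x 0≤x x≤1 m)
                   (QP.*-monoˡ-≤-nonNeg (c (2 + m)) {{ℚ.nonNegative (c≥0 (2 + m))}} (^-≤-square x 0≤x x≤1 m)) ⟩
  (c 1 ℚ.* x ℚ.+ sumFrom1 (suc m) c ℚ.* (x ℚ.* x)) ℚ.+ c (2 + m) ℚ.* (x ℚ.* x)
    ≡⟨ collect (c 1 ℚ.* x) (sumFrom1 (suc m) c) (c (2 + m)) (x ℚ.* x) ⟩
  c 1 ℚ.* x ℚ.+ sumFrom1 (suc (suc m)) c ℚ.* (x ℚ.* x) ∎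
  where
  open QP.≤-Reasoning
  open import Data.Rational.Solver using (module +-*-Solver)
  open +-*-Solver
  collect : ∀ a b d y → (a ℚ.+ b ℚ.* y) ℚ.+ d ℚ.* y ≡ a ℚ.+ (b ℚ.+ d) ℚ.* y
  collect = solve 4 (λ a b d y → (a :+ b :* y) :+ d :* y := a :+ (b :+ d) :* y) refl

sumFrom1-lower : (c : ℕ → ℚ) → (∀ i → 0ℚ ℚ.≤ c i) → ∀ x → 0ℚ ℚ.≤ x → ∀ m →
  c 1 ℚ.* x ℚ.≤ sumFrom1 (suc m) (λ i → c i ℚ.* x ^ℚ i)
sumFrom1-lower c c≥0 x 0≤x zero = QP.≤-reflexive (≡-sym (linear (c 1) x))
  where
  open import Data.Rational.Solver using (module +-*-Solver)
  open +-*-Solver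
  linear : ∀ a y → 0ℚ ℚ.+ a ℚ.* (y ℚ.* 1ℚ) ≡ a ℚ.* y
  linear = solve 2 (λ a y → con 0ℚ :+ a :* (y :* con 1ℚ) := a :* y) refl
sumFrom1-lower c c≥0 x 0≤x (suc m) =
  QP.≤-trans (sumFrom1-lower c c≥0 x 0≤x m) (≤-+-nonneg _ _ (*-nonneg _ _ (c≥0 (2 + m)) (^-nonneg x 0≤x (2 + m))))

-- If c, c' ≥ 0 and c₁ + 1 ≤ c'₁, then at x = 1/(Σ cᵢ + 1) the polynomial with coefficients
-- c' is strictly larger: the quadratic remainder (Σ cᵢ) x² is below x.
smallX-separation : (c c' : ℕ → ℚ) → (∀ i → 0ℚ ℚ.≤ c i) → (∀ i → 0ℚ ℚ.≤ c' i) → c 1 ℚ.+ 1ℚ ℚ.≤ c' 1 → ∀ m →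
  Σ ℚ λ x → (0ℚ ℚ.≤ x) × (sumFrom1 (suc m) (λ i → c i ℚ.* x ^ℚ i) ℚ.< sumFrom1 (suc m) (λ i → c' i ℚ.* x ^ℚ i))
smallX-separation c c' c≥0 c'≥0 c₁<c'₁ m = x , 0≤x , (begin-strict
  sumFrom1 (suc m) (λ i → c i ℚ.* x ^ℚ i) ≤⟨ sumFrom1-upper c c≥0 x 0≤x x≤1 m ⟩
  c 1 ℚ.* x ℚ.+ s ℚ.* (x ℚ.* x)           <⟨ QP.+-monoʳ-< (c 1 ℚ.* x) sx²<x ⟩
  c 1 ℚ.* x ℚ.+ x                         ≡⟨ factor (c 1) x ⟩
  (c 1 ℚ.+ 1ℚ) ℚ.* x                      ≤⟨ QP.*-monoʳ-≤-nonNeg x {{ℚ.nonNegative 0≤x}} c₁<c'₁ ⟩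
  c' 1 ℚ.* x                              ≤⟨ sumFrom1-lower c' c'≥0 x 0≤x m ⟩
  sumFrom1 (suc m) (λ i → c' i ℚ.* x ^ℚ i) ∎)
  where
  open QP.≤-Reasoning
  open import Data.Rational.Solver using (module +-*-Solver)
  open +-*-Solver
  factor : ∀ a z → a ℚ.* z ℚ.+ z ≡ (a ℚ.+ 1ℚ) ℚ.* z
  factor = solve 2 (λ a z → a :* z :+ z := (a :+ con 1ℚ) :* z) refl
  s : ℚ
  s = sumFrom1 (suc m) c
  0≤s : 0ℚ ℚ.≤ s
  0≤s = sumFrom1-nonneg c c≥0 (suc m)
  y : ℚ
  y = s ℚ.+ 1ℚ
  s<y : s ℚ.< y
  s<y = QP.≤-<-trans (QP.≤-reflexive (≡-sym (QP.+-identityʳ s))) (QP.+-monoʳ-< s (QP.positive⁻¹ 1ℚ))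
  1≤y : 1ℚ ℚ.≤ y
  1≤y = QP.≤-trans (QP.≤-reflexive (≡-sym (QP.+-identityˡ 1ℚ))) (QP.+-monoˡ-≤ 1ℚ 0≤s)
  instance
    y-positive : ℚ.Positive y
    y-positive = ℚ.positive (QP.≤-<-trans 0≤s s<y)
    y-nonZero : ℚ.NonZero y
    y-nonZero = QP.pos⇒nonZero y
  x : ℚ
  x = ℚ.1/ y
  instance
    x-positive : ℚ.Positive x
    x-positive = QP.1/pos⇒pos y
  0≤x : 0ℚ ℚ.≤ x
  0≤x = QP.<⇒≤ (QP.positive⁻¹ x)
  x≤1 : x ℚ.≤ 1ℚ
  x≤1 = begin
    x          ≡⟨ ≡-sym (QP.*-identityʳ x) ⟩
    x ℚ.* 1ℚ   ≤⟨ QP.*-monoˡ-≤-nonNeg x {{ℚ.nonNegative 0≤x}} 1≤y ⟩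
    x ℚ.* y    ≡⟨ QP.*-inverseˡ y ⟩
    1ℚ         ∎
  sx²<x : s ℚ.* (x ℚ.* x) ℚ.< x
  sx²<x = begin-strict
    s ℚ.* (x ℚ.* x)   ≡⟨ ≡-sym (QP.*-assoc s x x) ⟩
    (s ℚ.* x) ℚ.* x   <⟨ QP.*-monoˡ-<-pos x (QP.*-monoˡ-<-pos x s<y) ⟩
    (y ℚ.* x) ℚ.* x   ≡⟨ cong (ℚ._* x) (trans (QP.*-comm y x) (QP.*-inverseˡ y)) ⟩
    1ℚ ℚ.* x          ≡⟨ QP.*-identityˡ x ⟩
    x                 ∎

more-universal⇒larger : ∀ {n} (G G' : Graph n) → domCount G 1 < domCount G' 1 →
  Σ ℚ λ x → (0ℚ ℚ.≤ x) × (domPoly G x ℚ.< domPoly G' x)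
more-universal⇒larger {zero} G G' ()
more-universal⇒larger {suc m} G G' lt =
  smallX-separation (coeff ∘ domCount G) (coeff ∘ domCount G') (coeff-nonneg ∘ domCount G) (coeff-nonneg ∘ domCount G')
    (subst (ℚ._≤ coeff (domCount G' 1)) (coeff-+ (domCount G 1) 1)
           (coeff-mono (subst (_≤ domCount G' 1) (NP.+-comm 1 (domCount G 1)) lt)))
    m

optimal-against : ∀ {n n'} (G : Graph n) → Optimal G → (G' : Graph n') → n' ≡ n → edgeCount G' ≡ edgeCount G →
  ∀ x → 0ℚ ℚ.≤ x → domPoly G' x ℚ.≤ domPoly G x
optimal-against G opt G' refl = opt G'

optimal⇒most-universal : ∀ {n n'} (G : Graph n) → Optimal G → (G' : Graph n') → n' ≡ n → edgeCount G' ≡ edgeCount G →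
  domCount G' 1 ≤ domCount G 1
optimal⇒most-universal G opt G' refl e = NP.≮⇒≥ λ lt →
  let (x , 0≤x , G<G') = more-universal⇒larger G G' lt
  in QP.<-irrefl refl (QP.<-≤-trans G<G' (opt G' e x 0≤x))

+-cancelˡ-≤ : ∀ p a b → p ℚ.+ a ℚ.≤ p ℚ.+ b → a ℚ.≤ b
+-cancelˡ-≤ p a b h = subst₂ ℚ._≤_ (cancel p a) (cancel p b) (QP.+-monoʳ-≤ (ℚ.- p) h)
  where
  open import Data.Rational.Solver using (module +-*-Solver)
  open +-*-Solver
  cancel : ∀ p a → ℚ.- p ℚ.+ (p ℚ.+ a) ≡ a
  cancel = solve 2 (λ p a → (:- p) :+ (p :+ a) := a) refl

absorb-vertex : ∀ r k' (H : Graph (suc k')) → k' ≤ edgeCount H →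
  Σ (Graph k') λ H'' → edgeCount (join (complete (suc r)) H'') ≡ edgeCount (join (complete r) H)
absorb-vertex r k' H k'≤e = H'' , (begin
  edgeCount (join (complete (suc r)) H'')                   ≡⟨ edgeCount-join (complete (suc r)) H'' ⟩
  edgeCount (complete (suc r)) + suc r * k' + edgeCount H'' ≡⟨ cong₂ (λ a b → a + suc r * k' + b) (edgeCount-complete-suc r) eH'' ⟩
  (r + edgeCount (complete r)) + (k' + r * k') + (e ∸ k')   ≡⟨ regroup r (edgeCount (complete r)) k' (e ∸ k') ⟩
  edgeCount (complete r) + r * suc k' + (k' + (e ∸ k'))     ≡⟨ cong (edgeCount (complete r) + r * suc k' +_) (NP.m+[n∸m]≡n k'≤e) ⟩
  edgeCount (complete r) + r * suc k' + e                   ≡⟨ ≡-sym (edgeCount-join (complete r) H) ⟩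
  edgeCount (join (complete r) H)                           ∎)
  where
  open ≡-Reasoning
  e : ℕ
  e = edgeCount H
  regroup : ∀ r t k d → (r + t) + (k + r * k) + d ≡ t + r * suc k + (k + d)
  regroup = solve-∀ where open import Data.Nat.Tactic.RingSolver
  rest≤ : e ∸ k' ≤ edgeCount (complete k')
  rest≤ = subst (e ∸ k' ≤_) (NP.m+n∸m≡n k' (edgeCount (complete k')))
                (NP.∸-monoˡ-≤ k' (subst (e ≤_) (edgeCount-complete-suc k') (edgeCount≤complete H)))
  H'' : Graph k'
  H'' = proj₁ (edgeCount-realisable k' (e ∸ k') rest≤)
  eH'' : edgeCount H'' ≡ e ∸ k'
  eH'' = proj₂ (edgeCount-realisable k' (e ∸ k') rest≤)

-- If optimal G ≅ K_r ∨ H where r counts the universal vertices of G, then |E(H)| ≤ k − 2: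
-- otherwise K_{r+1} ∨ H'' from absorb-vertex is a competitor with r + 1 universal vertices.
optimal⇒sparse-rest : ∀ {n r k} (G : Graph n) (H : Graph k) → Optimal G → G ≅ join (complete r) H →
  domCount G 1 ≡ r → edgeCount H ≤ k ∸ 2
optimal⇒sparse-rest {k = zero} G H opt iso #univ = edgeCount≤complete H
optimal⇒sparse-rest {n} {r} {suc k'} G H opt iso #univ = NP.≮⇒≥ dense⇒⊥
  where
  dense⇒⊥ : k' ∸ 1 < edgeCount H → ⊥
  dense⇒⊥ dense = NP.<-irrefl refl (begin-strict
    r                                          <⟨ NP.n<1+n r ⟩
    suc r                                      ≤⟨ a≤#universal-join (suc r) H'' ⟩
    domCount (join (complete (suc r)) H'') 1   ≤⟨ optimal⇒most-universal G opt (join (complete (suc r)) H'') order edges ⟩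
    domCount G 1                               ≡⟨ #univ ⟩
    r                                          ∎)
    where
    open NP.≤-Reasoning
    module I = Isomorphism G (join (complete r) H) iso
    k'≤e : k' ≤ edgeCount H
    k'≤e = NP.≤-trans (NP.m≤n+m∸n k' 1) dense
    H'' : Graph k'
    H'' = proj₁ (absorb-vertex r k' H k'≤e)
    order : suc r + k' ≡ n
    order = trans (≡-sym (NP.+-suc r k')) (≡-sym (I.order))
    edges : edgeCount (join (complete (suc r)) H'') ≡ edgeCount G
    edges = trans (proj₂ (absorb-vertex r k' H k'≤e)) (≡-sym (I.edgeCount-preserved))

-- If optimal G ≅ K_r ∨ H then H is optimal: a competitor H' gives the competitor K_r ∨ H' of G,
-- and both domination polynomials share the summand meetingPoly r k.
optimal⇒optimal-rest : ∀ {n r k} (G : Graph n) (H : Graph k) → Optimal G → G ≅ join (complete r) H → Optimal H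
optimal⇒optimal-rest {n} {r} {k} G H opt iso H' eH' x 0≤x = +-cancelˡ-≤ (meetingPoly r k x) (domPoly H' x) (domPoly H x) (begin
  meetingPoly r k x ℚ.+ domPoly H' x   ≡⟨ ≡-sym (domPoly-join r H' x) ⟩
  domPoly (join (complete r) H') x     ≤⟨ optimal-against G opt (join (complete r) H') (≡-sym (I.order)) edges x 0≤x ⟩
  domPoly G x                          ≡⟨ I.domPoly-preserved x ⟩
  domPoly (join (complete r) H) x      ≡⟨ domPoly-join r H x ⟩
  meetingPoly r k x ℚ.+ domPoly H x    ∎)
  where
  open QP.≤-Reasoning
  module I = Isomorphism G (join (complete r) H) iso
  edges : edgeCount (join (complete r) H') ≡ edgeCount G
  edges = trans (edgeCount-join (complete r) H')
         (trans (cong (edgeCount (complete r) + r * k +_) eH')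
         (trans (≡-sym (edgeCount-join (complete r) H)) (≡-sym (I.edgeCount-preserved))))

lemma2p11 : (n : ℕ) (G : Graph n) → n ∸ 1 ≤ edgeCount G → Optimal G →
    ∃[ r ] ∃[ k ] (r + k ≡ n) × (Σ (Graph k) λ H →
    (G ≅ join (complete r) H) × (edgeCount H ≤ k ∸ 2) × Optimal H)
lemma2p11 n G _ opt = r , k , order , rest , iso , sparse , optimal
  where
  open UniversalDecomposition (universalDecomposition G)
  order : r + k ≡ n
  order = ≡-sym (Isomorphism.order G (join (complete r) rest) iso)
  sparse : edgeCount rest ≤ k ∸ 2
  sparse = optimal⇒sparse-rest G rest opt iso #universal
  optimal : Optimal rest
  optimal = optimal⇒optimal-rest G rest opt iso
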